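{- Let $G$ be an Eulerian graph of genus $g$ with $m$ edges, and let $T$ be a spanning tree of $G$. Then $$\operatorname{ec}(G)=\frac{1}{m\cdot 2^g}\sum_{\gamma\in M_2(E^c(T))}(-1)^{\sigma(\gamma)}\operatorname{trace}\left(W_{1,\gamma}^m\right)=\frac{1}{m\cdot 2^g}\sum_{\gamma\in M_2(E^c(T))}(-1)^{\sigma(\gamma)}\operatorname{trace}\left(A_\gamma^m\right).$$
   Context: A graph is a connected finite graph, loops and multiple edges allowed, with vertices $v_1,\dots,v_n$ and edges $e_1,\dots,e_m$; its genus is $g=m-n+1$. Each edge gives two mutually inverse oriented edges; for an oriented edge $\mathbf e$, $\mathbf e(0),\mathbf e(1)$ are its initial and terminal vertices and $\mathbf e^{ -1}(0)=\mathbf e(1)$, $\mathbf e^{ -1}(1)=\mathbf e(0)$. Fix an orientation (a choice of one "positively oriented" oriented edge $\mathbf e_k$ for each edge $e_k$); $\mathbf E(G)$ denotes the set of all $2m$ oriented edges. A closed walk of length $l$ is a sequence $\mathbf a_1\cdots\mathbf a_l$ of oriented edges with $\mathbf a_{i+1}(0)=\mathbf a_i(1)$ and $\mathbf a_l(1)=\mathbf a_1(0)$. An Eulerian circuit is a closed walk traversing every edge of $G$ exactly once (in one of its two directions); $G$ is Eulerian if it has one. $\operatorname{ec}(G)$ is the number of Eulerian cycles, i.e. equivalence classes of Eulerian circuits under cyclic rotation $\mathbf a_1\cdots\mathbf a_l\sim\mathbf a_2\cdots\mathbf a_l\mathbf a_1$ (a circuit and its reversal are counted as different). $C_1(G,\mathbb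 Z/2\mathbb Z)$ is the $\mathbb Z/2\mathbb Z$-vector space with basis the edges; $E^c(T)$ is the set of edges not in $T$ and $M_2(E^c(T))$ is the subspace of elements $\gamma=\sum_{e\in E^c(T)}c_e\, e$, $c_e\in\mathbb Z/2\mathbb Z$; $\sigma(\gamma)=\sum_{e\in E^c(T)}c_e$. For $\gamma\in M_2(E^c(T))$ and an oriented edge $\mathbf e$ with underlying edge $e$, put $\chi_\gamma(\mathbf e)=(-1)^{c_e}$ (with $c_e=0$ for $e\in T$). The twisted vertex adjacency matrix $A_\gamma$ is the $n\times n$ matrix whose $(i,j)$ entry is $\sum\chi_\gamma(\mathbf e)$ over oriented edges $\mathbf e$ with $\mathbf e(0)=v_i$, $\mathbf e(1)=v_j$. An oriented edge $\mathbf e$ feeds into $\mathbf e'$ if $\mathbf e'\neq\mathbf e^{ -1}$ and $\mathbf e(1)=\mathbf e'(0)$. The twisted edge adjacency matrix $W_{1,\gamma}$ is the $2m\times 2m$ matrix indexed by $\mathbf E(G)$ whose $(\mathbf e,\mathbf e')$ entry is $\chi_\gamma(\mathbf e)$ if $\mathbf e$ feeds into $\mathbf e'$ and $0$ otherwise. -}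

module Defs where

open import Data.Nat using (ℕ; zero; suc; _∸_) renaming (_+_ to _+ℕ_)
open import Data.Bool using (Bool; true; false; not; if_then_else_; _∧_)
open import Data.Fin using (Fin; zero; suc; _≟_)
open import Data.Product using (Σ; _×_; _,_; proj₁; proj₂; ∃; ∃-syntax)
open import Data.List using (List; []; _∷_; [_]; _∷ʳ_; map; concatMap; filterᵇ; allFin; foldr)
open import Data.List.Relation.Unary.All using (All)
open import Data.List.Relation.Unary.Unique.Propositional using (Unique)
open import Data.List.Relation.Binary.Permutation.Propositional using (_↭_)
open import Data.Integer using (ℤ; +_; -_; _+_; _*_; _^_; 0ℤ; 1ℤ)
import Data.Vec.Functional as VF
open import Relation.Nullary using (¬_; does)
open import Relation.Binary.PropositionalEquality using (_≡_; _≢_)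
open import Relation.Binary.Construct.Closure.Equivalence using (EqClosure)

-- Graphs: vertices Fin n, edges Fin m; the fixed orientation of edge k
-- is the positively oriented edge from src k to tgt k (loops and
-- multiple edges allowed).

record Graph : Set where
  field
    n   : ℕ
    m   : ℕ
    src : Fin m → Fin n
    tgt : Fin m → Fin n

module _ (G : Graph) where
  open Graph G

  -- oriented edges: (k , true) = 𝐞_k, (k , false) = 𝐞_k⁻¹
  OEdge : Set
  OEdge = Fin m × Bool

  edgeOf : OEdge → Fin m
  edgeOf = proj₁

  inv : OEdge → OEdge
  inv (k , b) = (k , not b)

  start : OEdge → Fin n
  start (k , true)  = src k
  start (k , false) = tgt k

  end : OEdge → Fin n
  end (k , true)  = tgt k
  end (k , false) = src k

  allOEdges : List OEdge
  allOEdges = concatMap (λ k → (k , true) ∷ (k , false) ∷ []) (allFin m)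

  data IsWalk : Fin n → Fin n → List OEdge → Set where
    nil  : ∀ {u} → IsWalk u u []
    cons : ∀ {u v a as} → start a ≡ u → IsWalk (end a) v as → IsWalk u v (a ∷ as)

  Connected : Set
  Connected = ∀ u v → ∃[ as ] IsWalk u v as

  IsClosedWalk : List OEdge → Set
  IsClosedWalk []       = Data.Empty.⊥
    where import Data.Empty
  IsClosedWalk (a ∷ as) = IsWalk (start a) (start a) (a ∷ as)

  IsEulerianCircuit : List OEdge → Set
  IsEulerianCircuit c = IsClosedWalk c × (map edgeOf c ↭ allFin m)

  Eulerian : Set
  Eulerian = ∃[ c ] IsEulerianCircuit c

  data Rot1 : List OEdge → List OEdge → Set where
    rot1 : ∀ a as → Rot1 (a ∷ as) (as ∷ʳ a)

  _∼rot_ : List OEdge → List OEdge → Set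
  _∼rot_ = EqClosure Rot1

  -- ec(G) = k : there are k Eulerian circuits f 0 … f (k-1) forming a
  -- transversal of the rotation classes of Eulerian circuits
  -- (i.e. k is the number of equivalence classes, the Eulerian cycles).
  IsEC : ℕ → Set
  IsEC k = Σ (Fin k → List OEdge) λ f →
             (∀ i → IsEulerianCircuit (f i))
           × (∀ c → IsEulerianCircuit c → ∃[ i ] (c ∼rot f i))
           × (∀ i j → f i ∼rot f j → i ≡ j)

  InT : (Fin m → Bool) → OEdge → Set
  InT T a = T (edgeOf a) ≡ true

  TConnected : (Fin m → Bool) → Set
  TConnected T = ∀ u v → ∃[ as ] (IsWalk u v as × All (InT T) as)

  TAcyclic : (Fin m → Bool) → Set
  TAcyclic T = ¬ (∃[ u ] ∃[ as ] (as ≢ [] × IsWalk u u as × All (InT T) as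
                                   × Unique (map edgeOf as)))

  IsSpanningTree : (Fin m → Bool) → Set
  IsSpanningTree T = TConnected T × TAcyclic T

  genus : ℕ
  genus = (m +ℕ 1) ∸ n

  -- γ ∈ C₁(G, ℤ/2) as the function e ↦ c_e ; M₂(E^c(T)) = those with
  -- c_e = 0 for e ∈ T.

  allChains : ∀ k → List (Fin k → Bool)
  allChains zero    = (λ ()) ∷ []
  allChains (suc k) = concatMap (λ f → (false VF.∷ f) ∷ (true VF.∷ f) ∷ []) (allChains k)

  andFin : ∀ {k} → (Fin k → Bool) → Bool
  andFin {zero}  p = true
  andFin {suc k} p = p zero ∧ andFin (λ i → p (suc i))

  inM2 : (Fin m → Bool) → (Fin m → Bool) → Bool
  inM2 T γ = andFin (λ e → not (T e ∧ γ e))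

  M2 : (Fin m → Bool) → List (Fin m → Bool)
  M2 T = filterᵇ (inM2 T) (allChains m)

  -- σ(γ) = Σ c_e  (as a natural number; only its parity matters)
  σ : (Fin m → Bool) → ℕ
  σ γ = countFin γ
    where
      countFin : ∀ {k} → (Fin k → Bool) → ℕ
      countFin {zero}  p = 0
      countFin {suc k} p = (if p zero then 1 else 0) +ℕ countFin (λ i → p (suc i))

  χ : (Fin m → Bool) → OEdge → ℤ
  χ γ a = if γ (edgeOf a) then - 1ℤ else 1ℤ

  _==V_ : Fin n → Fin n → Bool
  u ==V v = does (u ≟ v)

  _==E_ : Fin m → Fin m → Bool
  k ==E l = does (k ≟ l)

  _==O_ : OEdge → OEdge → Bool
  (k , b) ==O (l , c) = (k ==E l) ∧ does (b Data.Bool.≟ c)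
    where import Data.Bool

  feeds : OEdge → OEdge → Bool
  feeds a a' = not (a' ==O inv a) ∧ (end a ==V start a')

  sumList : List ℤ → ℤ
  sumList = foldr _+_ 0ℤ

  Aγ : (Fin m → Bool) → Fin n → Fin n → ℤ
  Aγ γ i j = sumList (map (λ a → if (start a ==V i) ∧ (end a ==V j) then χ γ a else 0ℤ) allOEdges)

  W1γ : (Fin m → Bool) → OEdge → OEdge → ℤ
  W1γ γ a a' = if feeds a a' then χ γ a else 0ℤ

-- square matrices over a finite index set I, given by a list `idx`
-- enumerating I (each element once) and a boolean equality test `eq`

module Matrix {I : Set} (idx : List I) (eq : I → I → Bool) where
  sumI : (I → ℤ) → ℤ
  sumI f = foldr (λ i s → f i + s) 0ℤ idx

  _·_ : (I → I → ℤ) → (I → I → ℤ) → (I → I → ℤ)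
  (M · N) i j = sumI (λ k → M i k * N k j)

  one : I → I → ℤ
  one i j = if eq i j then 1ℤ else 0ℤ

  pow : (I → I → ℤ) → ℕ → (I → I → ℤ)
  pow M zero    = one
  pow M (suc k) = M · pow M k

  trace : (I → I → ℤ) → ℤ
  trace M = sumI (λ i → M i i)

module _ (G : Graph) where
  open Graph G

  sumW : (Fin m → Bool) → ℤ
  sumW T = sumList G (map (λ γ → ((- 1ℤ) ^ σ G γ) * Matrix.trace (allOEdges G) (_==O_ G)
                                    (Matrix.pow (allOEdges G) (_==O_ G) (W1γ G γ) m))
                          (M2 G T))

  sumA : (Fin m → Bool) → ℤ
  sumA T = sumList G (map (λ γ → ((- 1ℤ) ^ σ G γ) * Matrix.trace (allFin n) (_==V_ G)
                                    (Matrix.pow (allFin n) (_==V_ G) (Aγ G γ) m))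
                          (M2 G T))

{-# OPTIONS --safe #-}
-- Expanding trace(W₁,γ^m) and trace(A_γ^m) as sums over words of m oriented edges, a word
-- contributes ∏ χ_γ over its letters if it is a closed non-backtracking cycle (resp. a closed walk) and 0
-- otherwise. Averaging (-1)^σ(γ) ∏ χ_γ over γ ∈ M₂(Eᶜ(T)) leaves 2^|Eᶜ(T)| for words traversing every
-- non-tree edge an odd number of times and 0 for all others. A closed walk with this property traverses
-- every tree edge oddly too, for otherwise it would cross the fundamental cut of an evenly traversed tree
-- edge, an even cut of the Eulerian graph, an odd number of times. With only m steps the surviving words
-- are therefore exactly the Eulerian circuits, m of them per Eulerian cycle. Finally |Eᶜ(T)| = g, as the
-- coboundary map from vertex 2-colourings onto labellings of T is two-to-one, so |T| = n - 1.

module Submission where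

open import Defs
open import Algebra.Bundles using (CommutativeRing; CommutativeSemigroup)
open import Algebra.Core using (Op₂)
open import Algebra.Structures using (IsCommutativeMonoid)
import Algebra.Properties.CommutativeSemigroup as CommutativeSemigroupProperties
open import Data.Bool using (Bool; true; false; not; if_then_else_; _∧_; _∨_; _xor_)
import Data.Bool as Bool
open import Data.Bool.Properties
  using (xor-∧-commutativeRing; xor-same; xor-comm; xor-assoc; not-involutive; if-eta;
         ∧-zeroʳ; ∨-zeroʳ; ¬-not; if-∧; if-not; T-≡)
open import Data.Empty using (⊥; ⊥-elim)
open import Data.Fin using (Fin; zero; suc; _≟_; toℕ; fromℕ<)
import Data.Fin.Properties as Fin
open import Data.Integer using (ℤ; +_; -_; 0ℤ; 1ℤ; _+_; _*_; _^_)
import Data.Integer.Properties as ℤ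
open import Data.List
  using (List; []; _∷_; _++_; _∷ʳ_; [_]; length; map; concatMap; filterᵇ; foldr; allFin; tabulate; lookup; deduplicate)
import Data.List.Properties as List
open import Data.List.Membership.Propositional using (_∈_)
import Data.List.Membership.Propositional.Properties as ∈
open import Data.List.Relation.Binary.Permutation.Propositional as ↭ using (_↭_; ↭-sym; ↭-trans; ↭-refl; ↭-prep; ↭⇒↭ₛ)
import Data.List.Relation.Binary.Permutation.Propositional.Properties as Perm
import Data.List.Relation.Binary.Permutation.Setoid.Properties as PermSetoid
open import Data.List.Relation.Unary.All as All using (All; []; _∷_)
import Data.List.Relation.Unary.All.Properties as All
open import Data.List.Relation.Unary.AllPairs using ([]; _∷_)
open import Data.List.Relation.Unary.Any as Any using (here; there)
import Data.List.Relation.Unary.Any.Properties as Any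
open import Data.List.Relation.Unary.Unique.Propositional using (Unique)
import Data.List.Relation.Unary.Unique.Propositional.Properties as Unique
import Data.List.Relation.Unary.Unique.DecPropositional.Properties as Unique
open import Data.Nat as ℕ using (ℕ; zero; suc; _∸_; _%_; _/_; _≤_; _<_; s≤s; z<s; NonZero; ≢-nonZero⁻¹)
import Data.Nat.Properties as ℕ
open import Data.Nat.DivMod using (m%n<n; m≡m%n+[m/n]*n)
open import Data.Nat.Induction using (<-wellFounded)
open import Data.Nat.Logarithm using (⌊log₂_⌋; ⌊log₂[2^n]⌋≡n)
open import Data.Product using (Σ-syntax; ∃-syntax; _×_; _,_; proj₁; proj₂; uncurry)
open import Data.Sum using (_⊎_; inj₁; inj₂)
import Data.Vec.Functional as VF
open import Function using (_∘_; id)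
open import Function.Bundles using (Equivalence)
open import Induction.WellFounded using (Acc; acc)
open import Relation.Binary.Definitions using (DecidableEquality; tri<; tri≈; tri>)
open import Relation.Binary.Construct.Closure.Equivalence as EqClosure using ()
open import Relation.Binary.Construct.Closure.ReflexiveTransitive using (ε; _◅_; _◅◅_)
open import Relation.Binary.Construct.Closure.Symmetric using (fwd; bwd)
open import Relation.Nullary using (Dec; yes; no; does)
open import Relation.Nullary.Decidable using (dec-true; dec-false; map′; _×-dec_)
open import Relation.Binary.PropositionalEquality as ≡ using (_≡_; _≢_; refl; cong; cong₂; sym; subst)
open ≡.≡-Reasoning

-- Finite sums

module CommutativeMonoidSum {A : Set} {_∙_ : Op₂ A} {ε : A}
         (isCommutativeMonoid : IsCommutativeMonoid _≡_ _∙_ ε) where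

  open IsCommutativeMonoid isCommutativeMonoid using (assoc; comm; identityˡ; identityʳ; isCommutativeSemigroup)

  private
    commutativeSemigroup : CommutativeSemigroup _ _
    commutativeSemigroup = record { isCommutativeSemigroup = isCommutativeSemigroup }

  open CommutativeSemigroupProperties commutativeSemigroup using (interchange)

  private variable
    X Y : Set

  ∑ : List X → (X → A) → A
  ∑ xs f = foldr (λ x s → f x ∙ s) ε xs

  ∑-cong : ∀ xs {f g : X → A} → (∀ x → f x ≡ g x) → ∑ xs f ≡ ∑ xs g
  ∑-cong []       f≗g = refl
  ∑-cong (x ∷ xs) f≗g = cong₂ _∙_ (f≗g x) (∑-cong xs f≗g)

  ∑-zero : ∀ xs {f : X → A} → (∀ x → f x ≡ ε) → ∑ xs f ≡ ε
  ∑-zero []       f≗ε = refl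
  ∑-zero (x ∷ xs) f≗ε = ≡.trans (cong₂ _∙_ (f≗ε x) (∑-zero xs f≗ε)) (identityˡ ε)

  ∑-++ : ∀ xs ys (f : X → A) → ∑ (xs ++ ys) f ≡ ∑ xs f ∙ ∑ ys f
  ∑-++ []       ys f = sym (identityˡ _)
  ∑-++ (x ∷ xs) ys f = ≡.trans (cong (f x ∙_) (∑-++ xs ys f)) (sym (assoc _ _ _))

  ∑-map : ∀ xs (g : X → Y) (f : Y → A) → ∑ (map g xs) f ≡ ∑ xs (f ∘ g)
  ∑-map []       g f = refl
  ∑-map (x ∷ xs) g f = cong (f (g x) ∙_) (∑-map xs g f)

  ∑-concatMap : ∀ xs (g : X → List Y) (f : Y → A) → ∑ (concatMap g xs) f ≡ ∑ xs (λ x → ∑ (g x) f)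
  ∑-concatMap []       g f = refl
  ∑-concatMap (x ∷ xs) g f = ≡.trans (∑-++ (g x) (concatMap g xs) f) (cong (∑ (g x) f ∙_) (∑-concatMap xs g f))

  ∑-filterᵇ : ∀ xs (p : X → Bool) (f : X → A) → ∑ (filterᵇ p xs) f ≡ ∑ xs (λ x → if p x then f x else ε)
  ∑-filterᵇ []       p f = refl
  ∑-filterᵇ (x ∷ xs) p f with p x
  ... | true  = cong (f x ∙_) (∑-filterᵇ xs p f)
  ... | false = ≡.trans (∑-filterᵇ xs p f) (sym (identityˡ _))

  ∑-distrib-∙ : ∀ xs (f g : X → A) → ∑ xs (λ x → f x ∙ g x) ≡ ∑ xs f ∙ ∑ xs g
  ∑-distrib-∙ []       f g = sym (identityˡ ε)
  ∑-distrib-∙ (x ∷ xs) f g = ≡.trans (cong ((f x ∙ g x) ∙_) (∑-distrib-∙ xs f g)) (interchange _ _ _ _)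

  ∑-comm : ∀ xs ys (f : X → Y → A) → ∑ xs (λ x → ∑ ys (f x)) ≡ ∑ ys (λ y → ∑ xs (λ x → f x y))
  ∑-comm []       ys f = sym (∑-zero ys (λ _ → refl))
  ∑-comm (x ∷ xs) ys f =
    ≡.trans (cong (∑ ys (f x) ∙_) (∑-comm xs ys f)) (sym (∑-distrib-∙ ys (f x) (λ y → ∑ xs (λ x′ → f x′ y))))

  ∑-↭ : ∀ {xs ys} (f : X → A) → xs ↭ ys → ∑ xs f ≡ ∑ ys f
  ∑-↭ f ↭.refl         = refl
  ∑-↭ f (↭.prep x p)   = cong (f x ∙_) (∑-↭ f p)
  ∑-↭ {xs = _ ∷ _ ∷ xs} {ys = _ ∷ _ ∷ ys} f (↭.swap x y p) = begin
    f x ∙ (f y ∙ ∑ xs f) ≡⟨ sym (assoc _ _ _) ⟩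
    (f x ∙ f y) ∙ ∑ xs f ≡⟨ cong₂ _∙_ (comm (f x) (f y)) (∑-↭ f p) ⟩
    (f y ∙ f x) ∙ ∑ ys f ≡⟨ assoc _ _ _ ⟩
    f y ∙ (f x ∙ ∑ ys f) ∎
  ∑-↭ f (↭.trans p q)  = ≡.trans (∑-↭ f p) (∑-↭ f q)

  ∑ᶠ : ∀ {k} → (Fin k → A) → A
  ∑ᶠ {zero}  f = ε
  ∑ᶠ {suc k} f = f zero ∙ ∑ᶠ (f ∘ suc)

  ∑ᶠ-cong : ∀ {k} {f g : Fin k → A} → (∀ x → f x ≡ g x) → ∑ᶠ f ≡ ∑ᶠ g
  ∑ᶠ-cong {zero}  f≗g = refl
  ∑ᶠ-cong {suc k} f≗g = cong₂ _∙_ (f≗g zero) (∑ᶠ-cong (f≗g ∘ suc))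

  ∑ᶠ-zero : ∀ {k} {f : Fin k → A} → (∀ x → f x ≡ ε) → ∑ᶠ f ≡ ε
  ∑ᶠ-zero {zero}  f≗ε = refl
  ∑ᶠ-zero {suc k} f≗ε = ≡.trans (cong₂ _∙_ (f≗ε zero) (∑ᶠ-zero (f≗ε ∘ suc))) (identityˡ ε)

  ∑ᶠ-distrib-∙ : ∀ {k} (f g : Fin k → A) → ∑ᶠ (λ x → f x ∙ g x) ≡ ∑ᶠ f ∙ ∑ᶠ g
  ∑ᶠ-distrib-∙ {zero}  f g = sym (identityˡ ε)
  ∑ᶠ-distrib-∙ {suc k} f g = ≡.trans (cong ((f zero ∙ g zero) ∙_) (∑ᶠ-distrib-∙ (f ∘ suc) (g ∘ suc))) (interchange _ _ _ _)

  ∑ᶠ-single : ∀ {k} (f : Fin k → A) a → (∀ x → x ≢ a → f x ≡ ε) → ∑ᶠ f ≡ f a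
  ∑ᶠ-single f zero    f≗ε = ≡.trans (cong (f zero ∙_) (∑ᶠ-zero (λ x → f≗ε (suc x) (λ ())))) (identityʳ _)
  ∑ᶠ-single f (suc a) f≗ε =
    ≡.trans (cong (_∙ ∑ᶠ (f ∘ suc)) (f≗ε zero (λ ()))) (≡.trans (identityˡ _)
      (∑ᶠ-single (f ∘ suc) a (λ x x≢a → f≗ε (suc x) (x≢a ∘ Fin.suc-injective))))

  ∑ᶠ-δ : ∀ {k} (a : Fin k) (g : Fin k → A) → ∑ᶠ (λ x → if does (a ≟ x) then g x else ε) ≡ g a
  ∑ᶠ-δ a g = ≡.trans (∑ᶠ-single _ a off) (if-≟-refl a)
    where
      off : ∀ x → x ≢ a → (if does (a ≟ x) then g x else ε) ≡ ε
      off x x≢a with a ≟ x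
      ... | yes a≡x = ⊥-elim (x≢a (sym a≡x))
      ... | no  _   = refl
      if-≟-refl : ∀ a → (if does (a ≟ a) then g a else ε) ≡ g a
      if-≟-refl a with a ≟ a
      ... | yes _   = refl
      ... | no  a≢a = ⊥-elim (a≢a refl)

  ∑ᶠ-δ′ : ∀ {k} (a : Fin k) (g : Fin k → A) → ∑ᶠ (λ x → if does (x ≟ a) then g x else ε) ≡ g a
  ∑ᶠ-δ′ a g = ≡.trans (∑ᶠ-cong flip) (∑ᶠ-δ a g)
    where
      flip : ∀ x → (if does (x ≟ a) then g x else ε) ≡ (if does (a ≟ x) then g x else ε)
      flip x with x ≟ a | a ≟ x
      ... | yes _   | yes _   = refl
      ... | no  _   | no  _   = refl
      ... | yes x≡a | no  a≢x = ⊥-elim (a≢x (sym x≡a))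
      ... | no  x≢a | yes a≡x = ⊥-elim (x≢a (sym a≡x))

  ∑-allFin : ∀ {k} (f : Fin k → A) → ∑ (allFin k) f ≡ ∑ᶠ f
  ∑-allFin f = go f (λ x → x)
    where
      go : ∀ {k} (f : X → A) (h : Fin k → X) → ∑ (tabulate h) f ≡ ∑ᶠ (f ∘ h)
      go {k = zero}  f h = refl
      go {k = suc k} f h = cong (f (h zero) ∙_) (go f (h ∘ suc))

module ℤ+ = CommutativeMonoidSum ℤ.+-0-isCommutativeMonoid
module ℤ* = CommutativeMonoidSum ℤ.*-1-isCommutativeMonoid
module Parity = CommutativeMonoidSum (CommutativeRing.+-isCommutativeMonoid xor-∧-commutativeRing)

open ℤ+
  using (∑; ∑-cong; ∑-zero; ∑-map; ∑-concatMap; ∑-filterᵇ; ∑-distrib-∙; ∑-comm; ∑-allFin; ∑ᶠ; ∑ᶠ-cong; ∑ᶠ-single; ∑ᶠ-δ)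
open ℤ*
  using ()
  renaming (∑ to ∏; ∑ᶠ to ∏ᶠ; ∑ᶠ-cong to ∏ᶠ-cong; ∑ᶠ-zero to ∏ᶠ-one; ∑ᶠ-distrib-∙ to ∏ᶠ-distrib-*; ∑ᶠ-δ to ∏ᶠ-δ)
open Parity using () renaming (∑ to ⨁; ∑ᶠ to ⨁ᶠ)

*-distribˡ-∑ : ∀ {X : Set} c (xs : List X) f → c * ∑ xs f ≡ ∑ xs (λ x → c * f x)
*-distribˡ-∑ c []       f = ℤ.*-zeroʳ c
*-distribˡ-∑ c (x ∷ xs) f = ≡.trans (ℤ.*-distribˡ-+ c (f x) _) (cong (_+_ (c * f x)) (*-distribˡ-∑ c xs f))

∑-const : ∀ {X : Set} (xs : List X) c → ∑ xs (λ _ → c) ≡ + length xs * c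
∑-const []       c = sym (ℤ.*-zeroˡ c)
∑-const (x ∷ xs) c = begin
  c + ∑ xs (λ _ → c)     ≡⟨ cong (_+_ c) (∑-const xs c) ⟩
  c + + length xs * c    ≡⟨ cong (_+ + length xs * c) (sym (ℤ.*-identityˡ c)) ⟩
  1ℤ * c + + length xs * c ≡⟨ sym (ℤ.*-distribʳ-+ c 1ℤ (+ length xs)) ⟩
  + suc (length xs) * c  ∎

if-*ʳ : ∀ b (x y : ℤ) → x * (if b then y else 0ℤ) ≡ (if b then x * y else 0ℤ)
if-*ʳ true  x y = refl
if-*ʳ false x y = ℤ.*-zeroʳ x

𝟙 : Bool → ℤ
𝟙 b = if b then 1ℤ else 0ℤ

-- Sums over M₂(Eᶜ(T))

module _ (G : Graph) where

  ∏ᶠ-𝟙 : ∀ {k} (p : Fin k → Bool) → ∏ᶠ (λ e → 𝟙 (p e)) ≡ 𝟙 (andFin G p)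
  ∏ᶠ-𝟙 {zero}  p = refl
  ∏ᶠ-𝟙 {suc k} p with p zero
  ... | true  = ≡.trans (ℤ.*-identityˡ _) (∏ᶠ-𝟙 (p ∘ suc))
  ... | false = refl

  ∑-allChains-avoiding-∏ : ∀ k (T : Fin k → Bool) (t u : Fin k → ℤ) →
    ∑ (allChains G k) (λ γ → if andFin G (λ e → not (T e ∧ γ e))
                             then ∏ᶠ (λ e → if γ e then t e else u e) else 0ℤ)
    ≡ ∏ᶠ (λ e → if T e then u e else u e + t e)
  ∑-allChains-avoiding-∏ zero    T t u = refl
  ∑-allChains-avoiding-∏ (suc k) T t u = begin
    ∑ (allChains G (suc k)) term
      ≡⟨ ∑-concatMap (allChains G k) _ term ⟩
    ∑ (allChains G k) (λ γ → term (false VF.∷ γ) + (term (true VF.∷ γ) + 0ℤ))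
      ≡⟨ ∑-cong (allChains G k) (λ γ → extend (T zero) _ (∏ᶠ (λ e → if γ e then t (suc e) else u (suc e)))) ⟩
    ∑ (allChains G k) (λ γ → c * term′ γ)
      ≡⟨ sym (*-distribˡ-∑ c (allChains G k) term′) ⟩
    c * ∑ (allChains G k) term′
      ≡⟨ cong (c *_) (∑-allChains-avoiding-∏ k (T ∘ suc) (t ∘ suc) (u ∘ suc)) ⟩
    c * ∏ᶠ (λ e → if T (suc e) then u (suc e) else u (suc e) + t (suc e)) ∎
    where
      term : (Fin (suc k) → Bool) → ℤ
      term γ = if andFin G (λ e → not (T e ∧ γ e)) then ∏ᶠ (λ e → if γ e then t e else u e) else 0ℤ
      term′ : (Fin k → Bool) → ℤ
      term′ γ = if andFin G (λ e → not (T (suc e) ∧ γ e)) then ∏ᶠ (λ e → if γ e then t (suc e) else u (suc e)) else 0ℤ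
      c : ℤ
      c = if T zero then u zero else u zero + t zero
      extend : ∀ T₀ b (P : ℤ) →
        (if not (T₀ ∧ false) ∧ b then u zero * P else 0ℤ) + ((if not (T₀ ∧ true) ∧ b then t zero * P else 0ℤ) + 0ℤ)
        ≡ (if T₀ then u zero else u zero + t zero) * (if b then P else 0ℤ)
      extend true  false P = sym (ℤ.*-zeroʳ (u zero))
      extend false false P = sym (ℤ.*-zeroʳ (u zero + t zero))
      extend true  true  P = ℤ.+-identityʳ _
      extend false true  P = ≡.trans (cong (_+_ (u zero * P)) (ℤ.+-identityʳ _)) (sym (ℤ.*-distribʳ-+ P (u zero) (t zero)))

  ∑-allChains-∏ : ∀ k (t u : Fin k → ℤ) →
    ∑ (allChains G k) (λ γ → ∏ᶠ (λ e → if γ e then t e else u e)) ≡ ∏ᶠ (λ e → u e + t e)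
  ∑-allChains-∏ k t u =
    ≡.trans (∑-cong (allChains G k) (λ γ → cong (λ b → if b then _ else 0ℤ) (sym (andFin-true k))))
            (∑-allChains-avoiding-∏ k (λ _ → false) t u)
    where
      andFin-true : ∀ k → andFin G {k} (λ _ → true) ≡ true
      andFin-true zero    = refl
      andFin-true (suc k) = andFin-true k

  open Graph G

  ∑-M₂-∏ : ∀ T (t u : Fin m → ℤ) →
    ∑ (M2 G T) (λ γ → ∏ᶠ (λ e → if γ e then t e else u e)) ≡ ∏ᶠ (λ e → if T e then u e else u e + t e)
  ∑-M₂-∏ T t u = ≡.trans (∑-filterᵇ (allChains G m) (inM2 G T) _) (∑-allChains-avoiding-∏ m T t u)

bouquet : ℕ → Graph
bouquet k = record { n = 1 ; m = k ; src = λ _ → zero ; tgt = λ _ → zero }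

-- σ G γ depends on G only through m; computing it on a bouquet of loops allows induction on m.
-1^σ : ∀ k (γ : Fin k → Bool) → (- 1ℤ) ^ σ (bouquet k) γ ≡ ∏ᶠ (λ e → if γ e then - 1ℤ else 1ℤ)
-1^σ zero    γ = refl
-1^σ (suc k) γ = ≡.trans (ℤ.^-distribˡ-+-* (- 1ℤ) (if γ zero then 1 else 0) (σ (bouquet k) (γ ∘ suc)))
                         (cong₂ _*_ (-1^bit (γ zero)) (-1^σ k (γ ∘ suc)))
  where
    -1^bit : ∀ b → (- 1ℤ) ^ (if b then 1 else 0) ≡ (if b then - 1ℤ else 1ℤ)
    -1^bit true  = refl
    -1^bit false = refl

module _ (G : Graph) where
  open Graph G

  odd : Fin m → List (OEdge G) → Bool
  odd e w = ⨁ w (λ a → _==E_ G (edgeOf G a) e)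

  ∏χ≡∏-odd : ∀ γ w → ∏ w (χ G γ) ≡ ∏ᶠ (λ e → if γ e ∧ odd e w then - 1ℤ else 1ℤ)
  ∏χ≡∏-odd γ []      = sym (∏ᶠ-one (λ e → if-∧-false (γ e)))
    where
      if-∧-false : ∀ g → (if g ∧ false then - 1ℤ else 1ℤ) ≡ 1ℤ
      if-∧-false true  = refl
      if-∧-false false = refl
  ∏χ≡∏-odd γ (a ∷ w) = begin
    χ G γ a * ∏ w (χ G γ)
      ≡⟨ cong₂ _*_ (sym (∏ᶠ-δ (edgeOf G a) (λ e → if γ e then - 1ℤ else 1ℤ))) (∏χ≡∏-odd γ w) ⟩
    ∏ᶠ (λ e → if does (edgeOf G a ≟ e) then (if γ e then - 1ℤ else 1ℤ) else 1ℤ)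
      * ∏ᶠ (λ e → if γ e ∧ odd e w then - 1ℤ else 1ℤ)
      ≡⟨ sym (∏ᶠ-distrib-* {m} _ _) ⟩
    ∏ᶠ (λ e → (if does (edgeOf G a ≟ e) then (if γ e then - 1ℤ else 1ℤ) else 1ℤ)
              * (if γ e ∧ odd e w then - 1ℤ else 1ℤ))
      ≡⟨ ∏ᶠ-cong (λ e → sym (flip (does (edgeOf G a ≟ e)) (γ e) (odd e w))) ⟩
    ∏ᶠ (λ e → if γ e ∧ odd e (a ∷ w) then - 1ℤ else 1ℤ) ∎
    where
      flip : ∀ d g o → (if g ∧ (d xor o) then - 1ℤ else 1ℤ)
                     ≡ (if d then (if g then - 1ℤ else 1ℤ) else 1ℤ) * (if g ∧ o then - 1ℤ else 1ℤ)
      flip true  true  true  = refl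
      flip true  true  false = refl
      flip true  false o     = refl
      flip false true  true  = refl
      flip false true  false = refl
      flip false false o     = refl

  cotreeWeight : (Fin m → Bool) → ℤ
  cotreeWeight T = ∏ᶠ (λ e → if T e then 1ℤ else + 2)

  ∑-M₂-sign : ∀ T w → ∑ (M2 G T) (λ γ → (- 1ℤ) ^ σ G γ * ∏ w (χ G γ))
                      ≡ cotreeWeight T * 𝟙 (andFin G (λ e → T e ∨ odd e w))
  ∑-M₂-sign T w = begin
    ∑ (M2 G T) (λ γ → (- 1ℤ) ^ σ G γ * ∏ w (χ G γ))
      ≡⟨ ∑-cong (M2 G T) signed ⟩
    ∑ (M2 G T) (λ γ → ∏ᶠ (λ e → if γ e then ±1 e else 1ℤ))
      ≡⟨ ∑-M₂-∏ G T ±1 (λ _ → 1ℤ) ⟩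
    ∏ᶠ (λ e → if T e then 1ℤ else 1ℤ + ±1 e)
      ≡⟨ ∏ᶠ-cong (λ e → split (T e) (odd e w)) ⟩
    ∏ᶠ (λ e → (if T e then 1ℤ else + 2) * 𝟙 (T e ∨ odd e w))
      ≡⟨ ∏ᶠ-distrib-* {m} _ _ ⟩
    cotreeWeight T * ∏ᶠ (λ e → 𝟙 (T e ∨ odd e w))
      ≡⟨ cong (cotreeWeight T *_) (∏ᶠ-𝟙 G {m} _) ⟩
    cotreeWeight T * 𝟙 (andFin G (λ e → T e ∨ odd e w)) ∎
    where
      ±1 : Fin m → ℤ
      ±1 e = if odd e w then 1ℤ else - 1ℤ
      merge : ∀ g o → (if g then - 1ℤ else 1ℤ) * (if g ∧ o then - 1ℤ else 1ℤ) ≡ (if g then (if o then 1ℤ else - 1ℤ) else 1ℤ)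
      merge true  true  = refl
      merge true  false = refl
      merge false o     = refl
      signed : ∀ γ → (- 1ℤ) ^ σ G γ * ∏ w (χ G γ) ≡ ∏ᶠ (λ e → if γ e then ±1 e else 1ℤ)
      signed γ = ≡.trans (cong₂ _*_ (-1^σ m γ) (∏χ≡∏-odd γ w))
                   (≡.trans (sym (∏ᶠ-distrib-* {m} _ _)) (∏ᶠ-cong (λ e → merge (γ e) (odd e w))))
      split : ∀ t o → (if t then 1ℤ else 1ℤ + (if o then 1ℤ else - 1ℤ)) ≡ (if t then 1ℤ else + 2) * 𝟙 (t ∨ o)
      split true  o     = refl
      split false true  = refl
      split false false = refl

-- Traces of powers as sums over words

words : {I : Set} → List I → ℕ → List (List I)
words idx zero    = [] ∷ []
words idx (suc l) = concatMap (λ a → map (a ∷_) (words idx l)) idx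

∑-words-cong : ∀ {I : Set} (idx : List I) l {f g : List I → ℤ} → (∀ w → length w ≡ l → f w ≡ g w) →
  ∑ (words idx l) f ≡ ∑ (words idx l) g
∑-words-cong idx zero    f≗g = cong (_+ 0ℤ) (f≗g [] refl)
∑-words-cong idx (suc l) {f} {g} f≗g = begin
  ∑ (words idx (suc l)) f                             ≡⟨ ∑-concatMap idx _ f ⟩
  ∑ idx (λ c → ∑ (map (c ∷_) (words idx l)) f)        ≡⟨ ∑-cong idx (λ c → ∑-map (words idx l) (c ∷_) f) ⟩
  ∑ idx (λ c → ∑ (words idx l) (f ∘ (c ∷_)))          ≡⟨ ∑-cong idx (λ c → ∑-words-cong idx l (λ w ∣w∣≡l → f≗g (c ∷ w) (cong suc ∣w∣≡l))) ⟩
  ∑ idx (λ c → ∑ (words idx l) (g ∘ (c ∷_)))          ≡⟨ sym (∑-cong idx (λ c → ∑-map (words idx l) (c ∷_) g)) ⟩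
  ∑ idx (λ c → ∑ (map (c ∷_) (words idx l)) g)        ≡⟨ sym (∑-concatMap idx _ g) ⟩
  ∑ (words idx (suc l)) g                             ∎

*-distribʳ-∑ : ∀ {X : Set} (xs : List X) f c → ∑ xs f * c ≡ ∑ xs (λ x → f x * c)
*-distribʳ-∑ xs f c =
  ≡.trans (ℤ.*-comm _ c) (≡.trans (*-distribˡ-∑ c xs f) (∑-cong xs (λ x → ℤ.*-comm c (f x))))

module PathExpansion {I : Set} (idx : List I) (eq : I → I → Bool) where
  open Matrix idx eq

  pathProduct : (I → I → ℤ) → I → List I → I → ℤ
  pathProduct M a []      b = one a b
  pathProduct M a (c ∷ w) b = M a c * pathProduct M c w b

  pow≡∑-words : ∀ M l a b → pow M l a b ≡ ∑ (words idx l) (λ w → pathProduct M a w b)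
  pow≡∑-words M zero    a b = sym (ℤ.+-identityʳ _)
  pow≡∑-words M (suc l) a b = begin
    ∑ idx (λ c → M a c * pow M l c b)
      ≡⟨ ∑-cong idx (λ c → cong (M a c *_) (pow≡∑-words M l c b)) ⟩
    ∑ idx (λ c → M a c * ∑ (words idx l) (λ w → pathProduct M c w b))
      ≡⟨ ∑-cong idx (λ c → *-distribˡ-∑ (M a c) (words idx l) (λ w → pathProduct M c w b)) ⟩
    ∑ idx (λ c → ∑ (words idx l) (λ w → pathProduct M a (c ∷ w) b))
      ≡⟨ ∑-cong idx (λ c → sym (∑-map (words idx l) (c ∷_) (λ w → pathProduct M a w b))) ⟩
    ∑ idx (λ c → ∑ (map (c ∷_) (words idx l)) (λ w → pathProduct M a w b))
      ≡⟨ sym (∑-concatMap idx (λ c → map (c ∷_) (words idx l)) (λ w → pathProduct M a w b)) ⟩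
    ∑ (words idx (suc l)) (λ w → pathProduct M a w b) ∎

  trace-pow≡∑-words : ∀ M l → trace (pow M l) ≡ ∑ (words idx l) (λ w → ∑ idx (λ b → pathProduct M b w b))
  trace-pow≡∑-words M l = ≡.trans (∑-cong idx (λ b → pow≡∑-words M l b b)) (∑-comm idx (words idx l) (λ b w → pathProduct M b w b))

sumList≡∑ : ∀ (G : Graph) {X : Set} (xs : List X) (f : X → ℤ) → sumList G (map f xs) ≡ ∑ xs f
sumList≡∑ G []       f = refl
sumList≡∑ G (x ∷ xs) f = cong (_+_ (f x)) (sumList≡∑ G xs f)

module _ (G : Graph) where
  open Graph G

  private
    O = OEdge G
    E = allOEdges G

  ∑-oriented : (f : O → ℤ) → ∑ E f ≡ ∑ᶠ (λ k → f (k , true) + (f (k , false) + 0ℤ))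
  ∑-oriented f = ≡.trans (∑-concatMap (allFin m) _ f) (∑-allFin (λ k → f (k , true) + (f (k , false) + 0ℤ)))

  ∑-oriented-δ : ∀ (x : O) (g : O → ℤ) → ∑ E (λ b → if _==O_ G x b then g b else 0ℤ) ≡ g x
  ∑-oriented-δ (l , d) g =
    ≡.trans (∑-oriented (λ b → if _==O_ G (l , d) b then g b else 0ℤ)) (≡.trans (∑ᶠ-cong {m} pick) (∑ᶠ-δ l (λ k → g (k , d))))
    where
      pick : ∀ k → (if _==O_ G (l , d) (k , true) then g (k , true) else 0ℤ)
                   + ((if _==O_ G (l , d) (k , false) then g (k , false) else 0ℤ) + 0ℤ)
                 ≡ (if _==E_ G l k then g (k , d) else 0ℤ)
      pick k with _==E_ G l k
      ... | false = refl
      ... | true  = same-orientation d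
        where
          same-orientation : ∀ d → (if does (d Bool.≟ true) then g (k , true) else 0ℤ)
                                   + ((if does (d Bool.≟ false) then g (k , false) else 0ℤ) + 0ℤ) ≡ g (k , d)
          same-orientation true  = ℤ.+-identityʳ _
          same-orientation false = ≡.trans (ℤ.+-identityˡ _) (ℤ.+-identityʳ _)

  isWalkᵇ : Fin n → Fin n → List O → Bool
  isWalkᵇ x y []      = _==V_ G x y
  isWalkᵇ x y (a ∷ w) = _==V_ G (start G a) x ∧ isWalkᵇ (end G a) y w

  closedWalkᵇ : List O → Bool
  closedWalkᵇ []      = false
  closedWalkᵇ (a ∷ w) = isWalkᵇ (end G a) (start G a) w

  walkSign : (Fin m → Bool) → Fin n → List O → Fin n → ℤ
  walkSign γ x w y = if isWalkᵇ x y w then ∏ w (χ G γ) else 0ℤ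

  walkSign-∷ : ∀ γ i a w j → walkSign γ i (a ∷ w) j ≡ (if _==V_ G (start G a) i then χ G γ a * walkSign γ (end G a) w j else 0ℤ)
  walkSign-∷ γ i a w j with _==V_ G (start G a) i
  ... | true  = sym (if-*ʳ (isWalkᵇ (end G a) j w) (χ G γ a) _)
  ... | false = refl

  open Matrix (allFin n) (_==V_ G) using () renaming (pow to powV; trace to traceV)

  ∑-Aγ-* : ∀ γ i (X : Fin n → ℤ) →
    ∑ (allFin n) (λ k → Aγ G γ i k * X k) ≡ ∑ E (λ a → if _==V_ G (start G a) i then χ G γ a * X (end G a) else 0ℤ)
  ∑-Aγ-* γ i X = begin
    ∑ (allFin n) (λ k → Aγ G γ i k * X k)
      ≡⟨ ∑-cong (allFin n) (λ k → ≡.trans (cong (_* X k) (sumList≡∑ G E (entry k))) (*-distribʳ-∑ E (entry k) (X k))) ⟩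
    ∑ (allFin n) (λ k → ∑ E (λ a → entry k a * X k))
      ≡⟨ ∑-comm (allFin n) E (λ k a → entry k a * X k) ⟩
    ∑ E (λ a → ∑ (allFin n) (λ k → entry k a * X k))
      ≡⟨ ∑-cong E (λ a → at-end a (_==V_ G (start G a) i)) ⟩
    ∑ E (λ a → if _==V_ G (start G a) i then χ G γ a * X (end G a) else 0ℤ) ∎
    where
      entry : Fin n → O → ℤ
      entry k a = if _==V_ G (start G a) i ∧ _==V_ G (end G a) k then χ G γ a else 0ℤ
      at-end : ∀ a b → ∑ (allFin n) (λ k → (if b ∧ _==V_ G (end G a) k then χ G γ a else 0ℤ) * X k)
                       ≡ (if b then χ G γ a * X (end G a) else 0ℤ)
      at-end a true  = ≡.trans (∑-cong (allFin n) (λ k → if-*ˡ (_==V_ G (end G a) k)))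
                         (≡.trans (∑-allFin {n} _) (∑ᶠ-δ (end G a) (λ k → χ G γ a * X k)))
        where
          if-*ˡ : ∀ c {k} → (if c then χ G γ a else 0ℤ) * X k ≡ (if c then χ G γ a * X k else 0ℤ)
          if-*ˡ true  = refl
          if-*ˡ false = refl
      at-end a false = ∑-zero (allFin n) (λ _ → refl)

  pow-Aγ : ∀ γ l i j → powV (Aγ G γ) l i j ≡ ∑ (words E l) (λ w → walkSign γ i w j)
  pow-Aγ γ zero    i j = sym (ℤ.+-identityʳ _)
  pow-Aγ γ (suc l) i j = begin
    ∑ (allFin n) (λ k → Aγ G γ i k * powV (Aγ G γ) l k j)
      ≡⟨ ∑-cong (allFin n) (λ k → cong (Aγ G γ i k *_) (pow-Aγ γ l k j)) ⟩
    ∑ (allFin n) (λ k → Aγ G γ i k * S k)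
      ≡⟨ ∑-Aγ-* γ i S ⟩
    ∑ E (λ a → if _==V_ G (start G a) i then χ G γ a * S (end G a) else 0ℤ)
      ≡⟨ ∑-cong E (λ a → push a (_==V_ G (start G a) i)) ⟩
    ∑ E (λ a → ∑ (words E l) (λ w → if _==V_ G (start G a) i then χ G γ a * walkSign γ (end G a) w j else 0ℤ))
      ≡⟨ ∑-cong E (λ a → ∑-cong (words E l) (λ w → sym (walkSign-∷ γ i a w j))) ⟩
    ∑ E (λ a → ∑ (words E l) (λ w → walkSign γ i (a ∷ w) j))
      ≡⟨ ∑-cong E (λ a → sym (∑-map (words E l) (a ∷_) (λ w → walkSign γ i w j))) ⟩
    ∑ E (λ a → ∑ (map (a ∷_) (words E l)) (λ w → walkSign γ i w j))
      ≡⟨ sym (∑-concatMap E (λ a → map (a ∷_) (words E l)) (λ w → walkSign γ i w j)) ⟩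
    ∑ (words E (suc l)) (λ w → walkSign γ i w j) ∎
    where
      S : Fin n → ℤ
      S k = ∑ (words E l) (λ w → walkSign γ k w j)
      push : ∀ a b → (if b then χ G γ a * S (end G a) else 0ℤ)
                     ≡ ∑ (words E l) (λ w → if b then χ G γ a * walkSign γ (end G a) w j else 0ℤ)
      push a true  = *-distribˡ-∑ (χ G γ a) (words E l) _
      push a false = sym (∑-zero (words E l) (λ _ → refl))

  trace-pow-Aγ : ∀ γ l .{{_ : NonZero l}} →
    traceV (powV (Aγ G γ) l) ≡ ∑ (words E l) (λ w → if closedWalkᵇ w then ∏ w (χ G γ) else 0ℤ)
  trace-pow-Aγ γ l = begin
    ∑ (allFin n) (λ i → powV (Aγ G γ) l i i)
      ≡⟨ ∑-cong (allFin n) (λ i → pow-Aγ γ l i i) ⟩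
    ∑ (allFin n) (λ i → ∑ (words E l) (λ w → walkSign γ i w i))
      ≡⟨ ∑-comm (allFin n) (words E l) (λ i w → walkSign γ i w i) ⟩
    ∑ (words E l) (λ w → ∑ (allFin n) (λ i → walkSign γ i w i))
      ≡⟨ ∑-words-cong E l closed ⟩
    ∑ (words E l) (λ w → if closedWalkᵇ w then ∏ w (χ G γ) else 0ℤ) ∎
    where
      closed : ∀ w → length w ≡ l → ∑ (allFin n) (λ i → walkSign γ i w i) ≡ (if closedWalkᵇ w then ∏ w (χ G γ) else 0ℤ)
      closed []      ∣w∣≡l = ⊥-elim (≢-nonZero⁻¹ l (sym ∣w∣≡l))
      closed (a ∷ w) _     = begin
        ∑ (allFin n) (λ i → walkSign γ i (a ∷ w) i)
          ≡⟨ ∑-allFin {n} _ ⟩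
        ∑ᶠ (λ i → walkSign γ i (a ∷ w) i)
          ≡⟨ ∑ᶠ-cong (λ i → if-∧ (_==V_ G (start G a) i)) ⟩
        ∑ᶠ (λ i → if _==V_ G (start G a) i then closingAt i else 0ℤ)
          ≡⟨ ∑ᶠ-δ (start G a) closingAt ⟩
        closingAt (start G a) ∎
        where
          closingAt : Fin n → ℤ
          closingAt i = if isWalkᵇ (end G a) i w then ∏ (a ∷ w) (χ G γ) else 0ℤ

  last : O → List O → O
  last c []      = c
  last c (d ∷ w) = last d w

  chainᵇ : O → List O → Bool
  chainᵇ c []      = true
  chainᵇ c (d ∷ w) = feeds G c d ∧ chainᵇ d w

  cycleᵇ : List O → Bool
  cycleᵇ []      = false
  cycleᵇ (c ∷ w) = feeds G (last c w) c ∧ chainᵇ c w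

  initSign : (Fin m → Bool) → O → List O → ℤ
  initSign γ c []      = 1ℤ
  initSign γ c (d ∷ w) = χ G γ c * initSign γ d w

  χ-last*initSign : ∀ γ c w → χ G γ (last c w) * initSign γ c w ≡ ∏ (c ∷ w) (χ G γ)
  χ-last*initSign γ c []      = refl
  χ-last*initSign γ c (d ∷ w) = begin
    χ G γ (last d w) * (χ G γ c * initSign γ d w)   ≡⟨ x∙yz≈y∙xz (χ G γ (last d w)) (χ G γ c) _ ⟩
    χ G γ c * (χ G γ (last d w) * initSign γ d w)   ≡⟨ cong (χ G γ c *_) (χ-last*initSign γ d w) ⟩
    χ G γ c * ∏ (d ∷ w) (χ G γ)                     ∎
    where open CommutativeSemigroupProperties ℤ.*-commutativeSemigroup using (x∙yz≈y∙xz)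

  open Matrix E (_==O_ G) using (one) renaming (pow to powE; trace to traceE)
  open PathExpansion E (_==O_ G)

  pathProduct-W1γ : ∀ γ c w b →
    pathProduct (W1γ G γ) c w b ≡ (if chainᵇ c w then initSign γ c w else 0ℤ) * one (last c w) b
  pathProduct-W1γ γ c []      b = sym (ℤ.*-identityˡ _)
  pathProduct-W1γ γ c (d ∷ w) b with feeds G c d
  ... | false = refl
  ... | true  = ≡.trans (cong (χ G γ c *_) (pathProduct-W1γ γ d w b))
                  (≡.trans (sym (ℤ.*-assoc (χ G γ c) _ _))
                    (cong (_* one (last d w) b) (if-*ʳ (chainᵇ d w) (χ G γ c) (initSign γ d w))))

  ∑-cyclicPathProduct : ∀ γ c w → ∑ E (λ b → pathProduct (W1γ G γ) b (c ∷ w) b)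
                                   ≡ (if cycleᵇ (c ∷ w) then ∏ (c ∷ w) (χ G γ) else 0ℤ)
  ∑-cyclicPathProduct γ c w = begin
    ∑ E (λ b → W1γ G γ b c * pathProduct (W1γ G γ) c w b)
      ≡⟨ ∑-cong E (λ b → cong (W1γ G γ b c *_) (pathProduct-W1γ γ c w b)) ⟩
    ∑ E (λ b → W1γ G γ b c * (s * one (last c w) b))
      ≡⟨ ∑-cong E closing ⟩
    ∑ E (λ b → if _==O_ G (last c w) b then W1γ G γ b c * s else 0ℤ)
      ≡⟨ ∑-oriented-δ (last c w) (λ b → W1γ G γ b c * s) ⟩
    W1γ G γ (last c w) c * s
      ≡⟨ close (feeds G (last c w) c) ⟩
    (if cycleᵇ (c ∷ w) then ∏ (c ∷ w) (χ G γ) else 0ℤ) ∎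
    where
      s : ℤ
      s = if chainᵇ c w then initSign γ c w else 0ℤ
      closing : ∀ b → W1γ G γ b c * (s * one (last c w) b)
                      ≡ (if _==O_ G (last c w) b then W1γ G γ b c * s else 0ℤ)
      closing b with _==O_ G (last c w) b
      ... | true  = cong (W1γ G γ b c *_) (ℤ.*-identityʳ s)
      ... | false = ≡.trans (cong (W1γ G γ b c *_) (ℤ.*-zeroʳ s)) (ℤ.*-zeroʳ (W1γ G γ b c))
      close : ∀ f → (if f then χ G γ (last c w) else 0ℤ) * s ≡ (if f ∧ chainᵇ c w then ∏ (c ∷ w) (χ G γ) else 0ℤ)
      close false = refl
      close true  = ≡.trans (if-*ʳ (chainᵇ c w) (χ G γ (last c w)) (initSign γ c w))
                      (cong (λ z → if chainᵇ c w then z else 0ℤ) (χ-last*initSign γ c w))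

  trace-pow-W1γ : ∀ γ l .{{_ : NonZero l}} →
    traceE (powE (W1γ G γ) l) ≡ ∑ (words E l) (λ w → if cycleᵇ w then ∏ w (χ G γ) else 0ℤ)
  trace-pow-W1γ γ l = ≡.trans (trace-pow≡∑-words (W1γ G γ) l) (∑-words-cong E l cyclic)
    where
      cyclic : ∀ w → length w ≡ l → ∑ E (λ b → pathProduct (W1γ G γ) b w b) ≡ (if cycleᵇ w then ∏ w (χ G γ) else 0ℤ)
      cyclic []      ∣w∣≡l = ⊥-elim (≢-nonZero⁻¹ l (sym ∣w∣≡l))
      cyclic (c ∷ w) _     = ∑-cyclicPathProduct γ c w

-- Closed walks in forests

data Repeat {A B : Set} (f : A → B) : List A → Set where
  repeat : ∀ P a Q b R → f a ≡ f b → Repeat f (P ++ a ∷ Q ++ b ∷ R)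

distinct⊎partner : ∀ {A B : Set} (f : A → B) → DecidableEquality B → ∀ a xs →
                   All (λ b → f a ≢ f b) xs ⊎ Σ[ Q ∈ List A ] Σ[ b ∈ A ] Σ[ R ∈ List A ] (xs ≡ Q ++ b ∷ R × f a ≡ f b)
distinct⊎partner f _≟ᴮ_ a []       = inj₁ []
distinct⊎partner f _≟ᴮ_ a (x ∷ xs) with f a ≟ᴮ f x | distinct⊎partner f _≟ᴮ_ a xs
... | yes fa≡fx | _                           = inj₂ ([] , x , xs , refl , fa≡fx)
... | no  fa≢fx | inj₁ none                   = inj₁ (fa≢fx ∷ none)
... | no  _     | inj₂ (Q , b , R , refl , e) = inj₂ (x ∷ Q , b , R , refl , e)

unique⊎repeat : ∀ {A B : Set} (f : A → B) → DecidableEquality B → ∀ xs → Unique (map f xs) ⊎ Repeat f xs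
unique⊎repeat f _≟ᴮ_ []       = inj₁ []
unique⊎repeat f _≟ᴮ_ (a ∷ xs) with distinct⊎partner f _≟ᴮ_ a xs
... | inj₂ (Q , b , R , refl , e) = inj₂ (repeat [] a Q b R e)
... | inj₁ none with unique⊎repeat f _≟ᴮ_ xs
...   | inj₁ unique               = inj₁ (All.map⁺ none ∷ unique)
...   | inj₂ (repeat P b Q c R e) = inj₂ (repeat (a ∷ P) b Q c R e)

module _ (G : Graph) where
  open Graph G

  private
    O = OEdge G

  start-inv : ∀ a → start G (inv G a) ≡ end G a
  start-inv (k , true)  = refl
  start-inv (k , false) = refl

  end-inv : ∀ a → end G (inv G a) ≡ start G a
  end-inv (k , true)  = refl
  end-inv (k , false) = refl

  same-edge : ∀ (a b : O) → edgeOf G a ≡ edgeOf G b → b ≡ a ⊎ b ≡ inv G a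
  same-edge (k , true)  (.k , true)  refl = inj₁ refl
  same-edge (k , true)  (.k , false) refl = inj₂ refl
  same-edge (k , false) (.k , true)  refl = inj₂ refl
  same-edge (k , false) (.k , false) refl = inj₁ refl

  walk-++ : ∀ {u v w xs ys} → IsWalk G u v xs → IsWalk G v w ys → IsWalk G u w (xs ++ ys)
  walk-++ nil        q = q
  walk-++ (cons e p) q = cons e (walk-++ p q)

  walk-++⁻ : ∀ {u w} xs {ys} → IsWalk G u w (xs ++ ys) → Σ[ v ∈ Fin n ] (IsWalk G u v xs × IsWalk G v w ys)
  walk-++⁻ []       p          = _ , nil , p
  walk-++⁻ (x ∷ xs) (cons e p) with walk-++⁻ xs p
  ... | v , p₁ , p₂ = v , cons e p₁ , p₂

  reverseWalk : List O → List O
  reverseWalk []      = []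
  reverseWalk (a ∷ w) = reverseWalk w ++ [ inv G a ]

  walk-reverse : ∀ {u v w} → IsWalk G u v w → IsWalk G v u (reverseWalk w)
  walk-reverse nil                   = nil
  walk-reverse (cons {a = a} refl p) =
    walk-++ (walk-reverse p) (cons (start-inv a) (subst (λ z → IsWalk G (end G (inv G a)) z []) (end-inv a) nil))

  All-reverseWalk : ∀ {P : O → Set} → (∀ {a} → P a → P (inv G a)) → ∀ {w} → All P w → All P (reverseWalk w)
  All-reverseWalk P-inv []       = []
  All-reverseWalk P-inv (p ∷ ps) = All.++⁺ (All-reverseWalk P-inv ps) (P-inv p ∷ [])

  ⨁-reverseWalk : ∀ (τ : Fin m → Bool) w → ⨁ (reverseWalk w) (τ ∘ edgeOf G) ≡ ⨁ w (τ ∘ edgeOf G)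
  ⨁-reverseWalk τ []      = refl
  ⨁-reverseWalk τ (a ∷ w) = ≡.trans (Parity.∑-↭ (τ ∘ edgeOf G) (Perm.++-comm (reverseWalk w) [ inv G a ]))
                                     (cong (τ (edgeOf G a) xor_) (⨁-reverseWalk τ w))

  odd-++ : ∀ e xs ys → odd G e (xs ++ ys) ≡ odd G e xs xor odd G e ys
  odd-++ e xs ys = Parity.∑-++ xs ys (λ a → _==E_ G (edgeOf G a) e)

  odd-↭ : ∀ e {xs ys} → xs ↭ ys → odd G e xs ≡ odd G e ys
  odd-↭ e = Parity.∑-↭ (λ a → _==E_ G (edgeOf G a) e)

  ⨁≡⨁ᶠ-odd : ∀ (τ : Fin m → Bool) w → ⨁ w (τ ∘ edgeOf G) ≡ ⨁ᶠ (λ e → τ e ∧ odd G e w)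
  ⨁≡⨁ᶠ-odd τ []      = sym (Parity.∑ᶠ-zero (λ e → ∧-zeroʳ (τ e)))
  ⨁≡⨁ᶠ-odd τ (a ∷ w) = begin
    τ (edgeOf G a) xor ⨁ w (τ ∘ edgeOf G)
      ≡⟨ cong₂ _xor_ (sym (Parity.∑ᶠ-δ (edgeOf G a) τ)) (⨁≡⨁ᶠ-odd τ w) ⟩
    ⨁ᶠ (λ e → if does (edgeOf G a ≟ e) then τ e else false) xor ⨁ᶠ (λ e → τ e ∧ odd G e w)
      ≡⟨ sym (Parity.∑ᶠ-distrib-∙ {m} _ _) ⟩
    ⨁ᶠ (λ e → (if does (edgeOf G a ≟ e) then τ e else false) xor (τ e ∧ odd G e w))
      ≡⟨ Parity.∑ᶠ-cong (λ e → merge (does (edgeOf G a ≟ e)) (τ e) (odd G e w)) ⟩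
    ⨁ᶠ (λ e → τ e ∧ odd G e (a ∷ w)) ∎
    where
      merge : ∀ d t o → (if d then t else false) xor (t ∧ o) ≡ t ∧ (d xor o)
      merge true  true  o = refl
      merge true  false o = refl
      merge false t     o = refl

  ClosedWalkIn : (Fin m → Bool) → List O → Set
  ClosedWalkIn T w = Σ[ u ∈ Fin n ] (IsWalk G u u w × All (InT G T) w)

  record Splitting (T : Fin m → Bool) (w : List O) : Set where
    field
      left right    : List O
      left-closed   : ClosedWalkIn T left
      right-closed  : ClosedWalkIn T right
      left-shorter  : length left < length w
      right-shorter : length right < length w
      odd-split     : ∀ e → odd G e w ≡ odd G e left xor odd G e right

  private
    length-parts : ∀ {x : List O} y z → x ↭ y ++ z → length x ≡ length y ℕ.+ length z
    length-parts y z x↭yz = ≡.trans (Perm.↭-length x↭yz) (List.length-++ y)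

    nonempty : ∀ P (a : O) R → 0 < length (P ++ a ∷ R)
    nonempty []      a R = z<s
    nonempty (_ ∷ _) a R = z<s

  -- When the repeated edge is traversed in opposite directions, its two traversals cancel in parity.
  split-at-repeat : ∀ {T} P a Q b R → edgeOf G a ≡ edgeOf G b → ClosedWalkIn T (P ++ a ∷ Q ++ b ∷ R) →
                    Splitting T (P ++ a ∷ Q ++ b ∷ R)
  split-at-repeat P a Q b R same (u , p , inT) with walk-++⁻ P p | All.++⁻ P inT
  ... | x , pP , cons sa pQbR | inP , ina ∷ inQbR with walk-++⁻ Q pQbR | All.++⁻ Q inQbR
  ... | y , pQ , cons sb pR | inQ , inb ∷ inR with same-edge a b same
  ... | inj₁ refl = record
    { left          = a ∷ Q
    ; right         = P ++ a ∷ R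
    ; left-closed   = start G a , cons refl (subst (λ z → IsWalk G (end G a) z Q) (sym sb) pQ) , ina ∷ inQ
    ; right-closed  = u , walk-++ pP (cons sa pR) , All.++⁺ inP (ina ∷ inR)
    ; left-shorter  = ≡.subst (_ <_) (sym ∣w∣) (ℕ.m<m+n (suc (length Q)) (nonempty P a R))
    ; right-shorter = ≡.subst (_ <_) (sym ∣w∣) (ℕ.m<n+m (length (P ++ a ∷ R)) z<s)
    ; odd-split     = λ e → ≡.trans (odd-↭ e reorder) (odd-++ e (a ∷ Q) (P ++ a ∷ R))
    }
    where
      reorder : P ++ a ∷ Q ++ a ∷ R ↭ (a ∷ Q) ++ P ++ a ∷ R
      reorder = Perm.shifts P (a ∷ Q)
      ∣w∣ : length (P ++ a ∷ Q ++ a ∷ R) ≡ suc (length Q) ℕ.+ length (P ++ a ∷ R)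
      ∣w∣ = length-parts (a ∷ Q) (P ++ a ∷ R) reorder
  ... | inj₂ refl = record
    { left          = Q
    ; right         = P ++ R
    ; left-closed   = end G a , subst (λ z → IsWalk G (end G a) z Q) (≡.trans (sym sb) (start-inv a)) pQ , inQ
    ; right-closed  = u , walk-++ pP (subst (λ z → IsWalk G z u R) (≡.trans (end-inv a) sa) pR) , All.++⁺ inP inR
    ; left-shorter  = ≡.subst (_ <_) (sym ∣w∣) (s≤s (ℕ.m≤n⇒m≤1+n (ℕ.m≤m+n (length Q) _)))
    ; right-shorter = ≡.subst (_ <_) (sym ∣w∣) (s≤s (ℕ.m≤n⇒m≤1+n (ℕ.m≤n+m (length (P ++ R)) _)))
    ; odd-split     = λ e → ≡.trans (odd-↭ e reorder) (≡.trans (cancel (_==E_ G (edgeOf G a) e) _) (odd-++ e Q (P ++ R)))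
    }
    where
      reorder : P ++ a ∷ Q ++ inv G a ∷ R ↭ a ∷ inv G a ∷ Q ++ P ++ R
      reorder = ↭-trans (Perm.shift a P _) (↭-prep a (↭-trans (Perm.shifts P Q)
                  (↭-trans (Perm.++⁺ˡ Q (Perm.shift (inv G a) P R)) (Perm.shift (inv G a) Q (P ++ R)))))
      ∣w∣ : length (P ++ a ∷ Q ++ inv G a ∷ R) ≡ suc (suc (length Q ℕ.+ length (P ++ R)))
      ∣w∣ = ≡.trans (Perm.↭-length reorder) (cong (ℕ.suc ∘ ℕ.suc) (List.length-++ Q))
      cancel : ∀ α o → α xor (α xor o) ≡ o
      cancel α o = ≡.trans (sym (xor-assoc α α o)) (cong (_xor o) (xor-same α))

  private
    xor≡true : ∀ {x y} → x xor y ≡ true → x ≡ true ⊎ y ≡ true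
    xor≡true {true}  _ = inj₁ refl
    xor≡true {false} e = inj₂ e

    odd⇒nonempty : ∀ {e w} → odd G e w ≡ true → w ≢ []
    odd⇒nonempty {w = []}    ()
    odd⇒nonempty {w = _ ∷ _} _ ()

  closedWalkIn-even : ∀ {T} → TAcyclic G T → ∀ {w} → ClosedWalkIn T w → ∀ e → odd G e w ≡ false
  closedWalkIn-even {T} acyclic {w} closed e = ¬-not (λ odd≡true → go w (<-wellFounded (length w)) closed odd≡true)
    where
      go : ∀ w → Acc _<_ (length w) → ClosedWalkIn T w → odd G e w ≡ true → ⊥
      go w (acc rec) closed@(u , p , inT) odd≡true with unique⊎repeat (edgeOf G) _≟_ w
      ... | inj₁ trail = acyclic (u , w , odd⇒nonempty odd≡true , p , inT , trail)
      ... | inj₂ (repeat P a Q b R same) with split-at-repeat P a Q b R same closed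
      ... | s with xor≡true (≡.trans (sym (Splitting.odd-split s e)) odd≡true)
      ... | inj₁ odd-left  = go _ (rec (Splitting.left-shorter s)) (Splitting.left-closed s) odd-left
      ... | inj₂ odd-right = go _ (rec (Splitting.right-shorter s)) (Splitting.right-closed s) odd-right

-- Potentials and the number of tree edges

2^-injective : ∀ {a b} → 2 ℕ.^ a ≡ 2 ℕ.^ b → a ≡ b
2^-injective {a} {b} eq = ≡.trans (sym (⌊log₂[2^n]⌋≡n a)) (≡.trans (cong ⌊log₂_⌋ eq) (⌊log₂[2^n]⌋≡n b))

+2^ : ∀ k → (+ 2) ^ k ≡ + (2 ℕ.^ k)
+2^ zero    = refl
+2^ (suc k) = ≡.trans (cong (+ 2 *_) (+2^ k)) (sym (ℤ.pos-* 2 (2 ℕ.^ k)))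

∏-if-2 : ∀ k (p : Fin k → Bool) → ∏ᶠ (λ e → if p e then + 2 else 1ℤ) ≡ (+ 2) ^ σ (bouquet k) p
∏-if-2 zero    p = refl
∏-if-2 (suc k) p with p zero
... | true  = cong (+ 2 *_) (∏-if-2 k (p ∘ suc))
... | false = ≡.trans (ℤ.*-identityˡ _) (∏-if-2 k (p ∘ suc))

σ-+-σ-not : ∀ k (p : Fin k → Bool) → σ (bouquet k) p ℕ.+ σ (bouquet k) (not ∘ p) ≡ k
σ-+-σ-not zero    p = refl
σ-+-σ-not (suc k) p with p zero
... | true  = cong suc (σ-+-σ-not k (p ∘ suc))
... | false = ≡.trans (ℕ.+-suc _ _) (cong suc (σ-+-σ-not k (p ∘ suc)))

𝟙-split : ∀ a b c → (b ≡ true → a ≡ true) → (c ≡ true → a ≡ true) → (a ≡ true → b ≡ true ⊎ c ≡ true) →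
          (b ≡ true → c ≡ true → ⊥) → 𝟙 a ≡ 𝟙 b + 𝟙 c
𝟙-split true  true  true  _   _   _     disj = ⊥-elim (disj refl refl)
𝟙-split true  true  false _   _   _     _    = refl
𝟙-split true  false true  _   _   _     _    = refl
𝟙-split true  false false _   _   cover _    with cover refl
... | inj₁ ()
... | inj₂ ()
𝟙-split false true  _     b⇒a _   _     _    with b⇒a refl
... | ()
𝟙-split false false true  _   c⇒a _     _    with c⇒a refl
... | ()
𝟙-split false false false _   _   _     _    = refl

module _ (G : Graph) where
  open Graph G

  private
    O = OEdge G

  andFin-sound : ∀ {k} (p : Fin k → Bool) → andFin G p ≡ true → ∀ i → p i ≡ true
  andFin-sound {suc k} p all i with p zero in p₀
  andFin-sound {suc k} p all zero    | true = p₀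
  andFin-sound {suc k} p all (suc i) | true = andFin-sound (p ∘ suc) all i

  andFin-complete : ∀ {k} (p : Fin k → Bool) → (∀ i → p i ≡ true) → andFin G p ≡ true
  andFin-complete {zero}  p all = refl
  andFin-complete {suc k} p all rewrite all zero = andFin-complete (p ∘ suc) (all ∘ suc)

  δ : (Fin n → Bool) → Fin m → Bool
  δ f e = f (src e) xor f (tgt e)

  δ-oriented : ∀ f (a : O) → f (start G a) xor f (end G a) ≡ δ f (edgeOf G a)
  δ-oriented f (k , true)  = refl
  δ-oriented f (k , false) = xor-comm (f (tgt k)) (f (src k))

  δ-xor : ∀ f g e → δ (λ v → f v xor g v) e ≡ δ f e xor δ g e
  δ-xor f g e = interchange (f (src e)) (g (src e)) (f (tgt e)) (g (tgt e))
    where open CommutativeSemigroupProperties (CommutativeRing.+-commutativeSemigroup xor-∧-commutativeRing)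

module SpanningTree (G : Graph) (T : Fin (Graph.m G) → Bool)
                    (connected : TConnected G T) (acyclic : TAcyclic G T) (root : Fin (Graph.n G)) where
  open Graph G

  private
    O = OEdge G

  path : Fin n → List O
  path v = proj₁ (connected root v)

  path-walk : ∀ v → IsWalk G root v (path v)
  path-walk v = proj₁ (proj₂ (connected root v))

  path-inT : ∀ v → All (InT G T) (path v)
  path-inT v = proj₂ (proj₂ (connected root v))

  ⨁-closedWalkIn : ∀ {q} → ClosedWalkIn G T q → ∀ (τ : Fin m → Bool) → ⨁ q (τ ∘ edgeOf G) ≡ false
  ⨁-closedWalkIn {q} closed τ = ≡.trans (⨁≡⨁ᶠ-odd G τ q) (Parity.∑ᶠ-zero even)
    where
      even : ∀ e → τ e ∧ odd G e q ≡ false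
      even e rewrite closedWalkIn-even G acyclic closed e = ∧-zeroʳ (τ e)

  potential : (Fin m → Bool) → Fin n → Bool
  potential τ v = ⨁ (path v) (τ ∘ edgeOf G)

  δ-potential : ∀ τ e → T e ≡ true → δ G (potential τ) e ≡ τ e
  δ-potential τ e e∈T = cancel {potential τ (src e)} trans-parity
    where
      a : O
      a = e , true
      cycle : List O
      cycle = path (src e) ++ a ∷ reverseWalk G (path (tgt e))
      closed : ClosedWalkIn G T cycle
      closed = root , walk-++ G (path-walk (src e)) (cons refl (walk-reverse G (path-walk (tgt e))))
                    , All.++⁺ (path-inT (src e)) (e∈T ∷ All-reverseWalk G (λ x → x) (path-inT (tgt e)))
      trans-parity : potential τ (src e) xor (τ e xor potential τ (tgt e)) ≡ false
      trans-parity = begin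
        potential τ (src e) xor (τ e xor potential τ (tgt e))
          ≡⟨ cong (λ z → potential τ (src e) xor (τ e xor z)) (sym (⨁-reverseWalk G τ (path (tgt e)))) ⟩
        potential τ (src e) xor ⨁ (a ∷ reverseWalk G (path (tgt e))) (τ ∘ edgeOf G)
          ≡⟨ sym (Parity.∑-++ (path (src e)) _ (τ ∘ edgeOf G)) ⟩
        ⨁ cycle (τ ∘ edgeOf G)
          ≡⟨ ⨁-closedWalkIn closed τ ⟩
        false ∎
      cancel : ∀ {x t y} → x xor (t xor y) ≡ false → x xor y ≡ t
      cancel {true}  {true}  {true}  ()
      cancel {true}  {true}  {false} _ = refl
      cancel {true}  {false} {true}  _ = refl
      cancel {true}  {false} {false} ()
      cancel {false} {true}  {true}  _ = refl
      cancel {false} {true}  {false} ()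
      cancel {false} {false} {true}  ()
      cancel {false} {false} {false} _ = refl

  δ-vanishes⇒constant : ∀ (h : Fin n → Bool) → (∀ e → T e ≡ true → δ G h e ≡ false) → ∀ v → h v ≡ h root
  δ-vanishes⇒constant h δh≡0 v = sym (along (path-walk v) (path-inT v))
    where
      xor≡false : ∀ {x y} → x xor y ≡ false → x ≡ y
      xor≡false {true}  {true}  _  = refl
      xor≡false {true}  {false} ()
      xor≡false {false} {true}  ()
      xor≡false {false} {false} _  = refl
      along : ∀ {x y p} → IsWalk G x y p → All (InT G T) p → h x ≡ h y
      along nil                    []         = refl
      along (cons {a = a} refl p) (a∈T ∷ inT) =
        ≡.trans (xor≡false (≡.trans (δ-oriented G h a) (δh≡0 (edgeOf G a) a∈T))) (along p inT)

  -- The three products below are indicator functions, written in the shape required by ∑-M₂-∏ and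
  -- ∑-allChains-∏: δf agrees with τ on T; f equals ψ; f is the complement of ψ.
  agreeOnTree : (Fin n → Bool) → (Fin m → Bool) → ℤ
  agreeOnTree f τ = ∏ᶠ (λ e → if τ e then (if T e then 𝟙 (δ G f e) else 1ℤ)
                                      else (if T e then 𝟙 (not (δ G f e)) else 1ℤ))

  equalTo oppositeTo : (Fin n → Bool) → (Fin n → Bool) → ℤ
  equalTo    f ψ = ∏ᶠ (λ v → if f v then 𝟙 (ψ v) else 𝟙 (not (ψ v)))
  oppositeTo f ψ = ∏ᶠ (λ v → if f v then 𝟙 (not (ψ v)) else 𝟙 (ψ v))

  agreesᵇ : (Fin n → Bool) → (Fin m → Bool) → Bool
  agreesᵇ f τ = andFin G (λ e → not (T e ∧ (τ e xor δ G f e)))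

  agreeOnTree≡𝟙 : ∀ f τ → agreeOnTree f τ ≡ 𝟙 (agreesᵇ f τ)
  agreeOnTree≡𝟙 f τ = ≡.trans (∏ᶠ-cong (λ e → pointwise (τ e) (T e) (δ G f e))) (∏ᶠ-𝟙 G {m} _)
    where
      pointwise : ∀ t T′ d → (if t then (if T′ then 𝟙 d else 1ℤ) else (if T′ then 𝟙 (not d) else 1ℤ))
                             ≡ 𝟙 (not (T′ ∧ (t xor d)))
      pointwise true  true  true  = refl
      pointwise true  true  false = refl
      pointwise true  false d     = refl
      pointwise false true  true  = refl
      pointwise false true  false = refl
      pointwise false false d     = refl

  equalTo≡𝟙 : ∀ f ψ → equalTo f ψ ≡ 𝟙 (andFin G (λ v → not (f v xor ψ v)))
  equalTo≡𝟙 f ψ = ≡.trans (∏ᶠ-cong (λ v → pointwise (f v) (ψ v))) (∏ᶠ-𝟙 G {n} _)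
    where
      pointwise : ∀ x y → (if x then 𝟙 y else 𝟙 (not y)) ≡ 𝟙 (not (x xor y))
      pointwise true  y = cong 𝟙 (sym (not-involutive y))
      pointwise false y = refl

  oppositeTo≡𝟙 : ∀ f ψ → oppositeTo f ψ ≡ 𝟙 (andFin G (λ v → f v xor ψ v))
  oppositeTo≡𝟙 f ψ = ≡.trans (∏ᶠ-cong (λ v → pointwise (f v) (ψ v))) (∏ᶠ-𝟙 G {n} _)
    where
      pointwise : ∀ x y → (if x then 𝟙 (not y) else 𝟙 y) ≡ 𝟙 (x xor y)
      pointwise true  y = refl
      pointwise false y = refl

  private
    not≡true : ∀ {x} → not x ≡ true → x ≡ false
    not≡true {false} _ = refl

  mismatch≡δ-xor : ∀ f τ e → T e ≡ true → τ e xor δ G f e ≡ δ G (λ v → f v xor potential τ v) e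
  mismatch≡δ-xor f τ e e∈T = sym (≡.trans (δ-xor G f (potential τ) e)
                                   (≡.trans (cong (δ G f e xor_) (δ-potential τ e e∈T)) (xor-comm (δ G f e) (τ e))))

  agreesᵇ-complete : ∀ f τ → (∀ e → T e ≡ true → δ G (λ v → f v xor potential τ v) e ≡ false) → agreesᵇ f τ ≡ true
  agreesᵇ-complete f τ δh≡0 = andFin-complete G _ agree
    where
      agree : ∀ e → not (T e ∧ (τ e xor δ G f e)) ≡ true
      agree e with T e in e∈T
      ... | true  = cong not (≡.trans (mismatch≡δ-xor f τ e e∈T) (δh≡0 e e∈T))
      ... | false = refl

  agreesᵇ-sound : ∀ f τ → agreesᵇ f τ ≡ true → ∀ e → T e ≡ true → δ G (λ v → f v xor potential τ v) e ≡ false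
  agreesᵇ-sound f τ agrees e e∈T =
    ≡.trans (sym (mismatch≡δ-xor f τ e e∈T)) (not≡true (subst (λ t → not (t ∧ _) ≡ true) e∈T (andFin-sound G _ agrees e)))

  ∑-agreeOnTree : ∀ f → ∑ (M2 G (not ∘ T)) (agreeOnTree f) ≡ 1ℤ
  ∑-agreeOnTree f = ≡.trans (∑-M₂-∏ G (not ∘ T) _ _) (∏ᶠ-one (λ e → exactlyOne (T e) (δ G f e)))
    where
      exactlyOne : ∀ t d → (if not t then (if t then 𝟙 (not d) else 1ℤ)
                            else (if t then 𝟙 (not d) else 1ℤ) + (if t then 𝟙 d else 1ℤ)) ≡ 1ℤ
      exactlyOne true  true  = refl
      exactlyOne true  false = refl
      exactlyOne false d     = refl

  ∑-equalTo : ∀ ψ → ∑ (allChains G n) (λ f → equalTo f ψ) ≡ 1ℤ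
  ∑-equalTo ψ = ≡.trans (∑-allChains-∏ G n _ _) (∏ᶠ-one (λ v → one (ψ v)))
    where
      one : ∀ y → 𝟙 (not y) + 𝟙 y ≡ 1ℤ
      one true  = refl
      one false = refl

  ∑-oppositeTo : ∀ ψ → ∑ (allChains G n) (λ f → oppositeTo f ψ) ≡ 1ℤ
  ∑-oppositeTo ψ = ≡.trans (∑-allChains-∏ G n _ _) (∏ᶠ-one (λ v → one (ψ v)))
    where
      one : ∀ y → 𝟙 y + 𝟙 (not y) ≡ 1ℤ
      one true  = refl
      one false = refl

  agreeOnTree≡equal+opposite : ∀ f τ → agreeOnTree f τ ≡ equalTo f (potential τ) + oppositeTo f (potential τ)
  agreeOnTree≡equal+opposite f τ = begin
    agreeOnTree f τ        ≡⟨ agreeOnTree≡𝟙 f τ ⟩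
    𝟙 (agreesᵇ f τ)        ≡⟨ 𝟙-split (agreesᵇ f τ) equal opposite
                                (λ eq → agreesᵇ-complete f τ (λ e _ → δ-constant false (λ v → not≡true (andFin-sound G _ eq v)) e))
                                (λ op → agreesᵇ-complete f τ (λ e _ → δ-constant true (andFin-sound G _ op) e))
                                cover disjoint ⟩
    𝟙 equal + 𝟙 opposite   ≡⟨ sym (cong₂ _+_ (equalTo≡𝟙 f ψ) (oppositeTo≡𝟙 f ψ)) ⟩
    equalTo f ψ + oppositeTo f ψ ∎
    where
      ψ h : Fin n → Bool
      ψ = potential τ
      h v = f v xor ψ v
      equal opposite : Bool
      equal    = andFin G (λ v → not (h v))
      opposite = andFin G h
      δ-constant : ∀ c → (∀ v → h v ≡ c) → ∀ e → δ G h e ≡ false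
      δ-constant c h≡c e rewrite h≡c (src e) | h≡c (tgt e) = xor-same c
      cover : agreesᵇ f τ ≡ true → equal ≡ true ⊎ opposite ≡ true
      cover agrees with h root in h-root
      ... | false = inj₁ (andFin-complete G _ (λ v → cong not (≡.trans (δ-vanishes⇒constant h (agreesᵇ-sound f τ agrees) v) h-root)))
      ... | true  = inj₂ (andFin-complete G _ (λ v → ≡.trans (δ-vanishes⇒constant h (agreesᵇ-sound f τ agrees) v) h-root))
      disjoint : equal ≡ true → opposite ≡ true → ⊥
      disjoint eq op with h root | andFin-sound G _ eq root | andFin-sound G _ op root
      ... | false | _  | ()
      ... | true  | () | _

  ∑-colourings : ∑ (allChains G n) (λ f → 1ℤ) ≡ (+ 2) ^ n
  ∑-colourings = ≡.trans (∑-cong (allChains G n) (λ f → sym (∏ᶠ-one (λ v → if-eta (f v)))))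
                         (≡.trans (∑-allChains-∏ G n (λ _ → 1ℤ) (λ _ → 1ℤ)) (∏ᶠ-2 n))
    where
      ∏ᶠ-2 : ∀ k → ∏ᶠ {k} (λ _ → + 2) ≡ (+ 2) ^ k
      ∏ᶠ-2 zero    = refl
      ∏ᶠ-2 (suc k) = cong (+ 2 *_) (∏ᶠ-2 k)

  ∑-treeLabellings : ∑ (M2 G (not ∘ T)) (λ τ → 1ℤ) ≡ (+ 2) ^ σ G T
  ∑-treeLabellings = begin
    ∑ (M2 G (not ∘ T)) (λ τ → 1ℤ)                                  ≡⟨ ∑-cong (M2 G (not ∘ T)) (λ τ → sym (∏ᶠ-one (λ e → if-eta (τ e)))) ⟩
    ∑ (M2 G (not ∘ T)) (λ τ → ∏ᶠ (λ e → if τ e then 1ℤ else 1ℤ))    ≡⟨ ∑-M₂-∏ G (not ∘ T) (λ _ → 1ℤ) (λ _ → 1ℤ) ⟩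
    ∏ᶠ (λ e → if not (T e) then 1ℤ else + 2)                       ≡⟨ ∏ᶠ-cong (λ e → if-not (T e)) ⟩
    ∏ᶠ (λ e → if T e then + 2 else 1ℤ)                             ≡⟨ ∏-if-2 m T ⟩
    (+ 2) ^ σ G T                                                  ∎

  -- Count the pairs (f, τ) with δf = τ on T in two ways: each vertex colouring f determines τ, and each τ
  -- has exactly two potentials; so 2 ^ n = 2 · 2 ^ |T|.
  vertices≡1+treeEdges : n ≡ suc (σ G T)
  vertices≡1+treeEdges = 2^-injective (ℤ.+-injective (begin
    + (2 ℕ.^ n)                                                    ≡⟨ sym (+2^ n) ⟩
    (+ 2) ^ n                                                      ≡⟨ sym ∑-colourings ⟩
    ∑ (allChains G n) (λ f → 1ℤ)                                   ≡⟨ ∑-cong (allChains G n) (λ f → sym (∑-agreeOnTree f)) ⟩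
    ∑ (allChains G n) (λ f → ∑ (M2 G (not ∘ T)) (agreeOnTree f))    ≡⟨ ∑-comm (allChains G n) (M2 G (not ∘ T)) agreeOnTree ⟩
    ∑ (M2 G (not ∘ T)) (λ τ → ∑ (allChains G n) (λ f → agreeOnTree f τ))
      ≡⟨ ∑-cong (M2 G (not ∘ T)) two-potentials ⟩
    ∑ (M2 G (not ∘ T)) (λ τ → 1ℤ + 1ℤ)                             ≡⟨ ∑-distrib-∙ (M2 G (not ∘ T)) (λ _ → 1ℤ) (λ _ → 1ℤ) ⟩
    ∑ (M2 G (not ∘ T)) (λ τ → 1ℤ) + ∑ (M2 G (not ∘ T)) (λ τ → 1ℤ)  ≡⟨ cong₂ _+_ ∑-treeLabellings ∑-treeLabellings ⟩
    (+ 2) ^ σ G T + (+ 2) ^ σ G T                                  ≡⟨ x+x≡2*x ((+ 2) ^ σ G T) ⟩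
    (+ 2) ^ suc (σ G T)                                            ≡⟨ +2^ (suc (σ G T)) ⟩
    + (2 ℕ.^ suc (σ G T))                                          ∎))
    where
      two-potentials : ∀ τ → ∑ (allChains G n) (λ f → agreeOnTree f τ) ≡ 1ℤ + 1ℤ
      two-potentials τ = begin
        ∑ (allChains G n) (λ f → agreeOnTree f τ)
          ≡⟨ ∑-cong (allChains G n) (λ f → agreeOnTree≡equal+opposite f τ) ⟩
        ∑ (allChains G n) (λ f → equalTo f (potential τ) + oppositeTo f (potential τ))
          ≡⟨ ∑-distrib-∙ (allChains G n) (λ f → equalTo f (potential τ)) (λ f → oppositeTo f (potential τ)) ⟩
        ∑ (allChains G n) (λ f → equalTo f (potential τ)) + ∑ (allChains G n) (λ f → oppositeTo f (potential τ))
          ≡⟨ cong₂ _+_ (∑-equalTo (potential τ)) (∑-oppositeTo (potential τ)) ⟩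
        1ℤ + 1ℤ ∎
      x+x≡2*x : ∀ x → x + x ≡ + 2 * x
      x+x≡2*x x = sym (≡.trans (ℤ.*-distribʳ-+ x 1ℤ 1ℤ) (cong₂ _+_ (ℤ.*-identityˡ x) (ℤ.*-identityˡ x)))

  cotreeWeight≡2^genus : cotreeWeight G T ≡ (+ 2) ^ genus G
  cotreeWeight≡2^genus = begin
    ∏ᶠ (λ e → if T e then 1ℤ else + 2)            ≡⟨ ∏ᶠ-cong (λ e → sym (if-not (T e))) ⟩
    ∏ᶠ (λ e → if not (T e) then + 2 else 1ℤ)      ≡⟨ ∏-if-2 m (not ∘ T) ⟩
    (+ 2) ^ σ G (not ∘ T)                         ≡⟨ cong ((+ 2) ^_) (sym genus≡cotreeEdges) ⟩
    (+ 2) ^ genus G                               ∎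
    where
      genus≡cotreeEdges : genus G ≡ σ G (not ∘ T)
      genus≡cotreeEdges = begin
        (m ℕ.+ 1) ∸ n                                       ≡⟨ cong₂ (λ a b → (a ℕ.+ 1) ∸ b) (sym (σ-+-σ-not m T)) vertices≡1+treeEdges ⟩
        ((σ G T ℕ.+ σ G (not ∘ T)) ℕ.+ 1) ∸ suc (σ G T)      ≡⟨ cong (_∸ suc (σ G T)) (ℕ.+-comm _ 1) ⟩
        suc (σ G T) ℕ.+ σ G (not ∘ T) ∸ suc (σ G T)         ≡⟨ ℕ.m+n∸m≡n (suc (σ G T)) _ ⟩
        σ G (not ∘ T)                                       ∎

-- Rotations

module _ {A : Set} where

  rotate₁ : List A → List A
  rotate₁ []       = []
  rotate₁ (x ∷ xs) = xs ∷ʳ x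

  rotate : ℕ → List A → List A
  rotate zero    xs = xs
  rotate (suc r) xs = rotate r (rotate₁ xs)

  rotate-++ : ∀ xs ys → rotate (length xs) (xs ++ ys) ≡ ys ++ xs
  rotate-++ []       ys = sym (List.++-identityʳ ys)
  rotate-++ (x ∷ xs) ys = begin
    rotate (length xs) ((xs ++ ys) ∷ʳ x)   ≡⟨ cong (rotate (length xs)) (List.++-assoc xs ys [ x ]) ⟩
    rotate (length xs) (xs ++ ys ∷ʳ x)     ≡⟨ rotate-++ xs (ys ∷ʳ x) ⟩
    (ys ∷ʳ x) ++ xs                        ≡⟨ List.++-assoc ys [ x ] xs ⟩
    ys ++ x ∷ xs                           ∎

  rotate-length : ∀ xs → rotate (length xs) xs ≡ xs
  rotate-length xs = ≡.trans (cong (rotate (length xs)) (sym (List.++-identityʳ xs))) (rotate-++ xs [])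

  rotate-+ : ∀ r s xs → rotate (r ℕ.+ s) xs ≡ rotate s (rotate r xs)
  rotate-+ zero    s xs = refl
  rotate-+ (suc r) s xs = rotate-+ r s (rotate₁ xs)

  length-rotate : ∀ r xs → length (rotate r xs) ≡ length xs
  length-rotate zero    xs       = refl
  length-rotate (suc r) []       = length-rotate r []
  length-rotate (suc r) (x ∷ xs) = ≡.trans (length-rotate r (xs ∷ʳ x)) (≡.trans (List.length-++ xs) (ℕ.+-comm (length xs) 1))

  rotate-*-length : ∀ q xs → rotate (q ℕ.* length xs) xs ≡ xs
  rotate-*-length zero    xs = refl
  rotate-*-length (suc q) xs = begin
    rotate (length xs ℕ.+ q ℕ.* length xs) xs          ≡⟨ rotate-+ (length xs) (q ℕ.* length xs) xs ⟩
    rotate (q ℕ.* length xs) (rotate (length xs) xs)  ≡⟨ cong (rotate (q ℕ.* length xs)) (rotate-length xs) ⟩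
    rotate (q ℕ.* length xs) xs                       ≡⟨ rotate-*-length q xs ⟩
    xs                                                ∎

  rotate-% : ∀ r xs ℓ .{{_ : NonZero ℓ}} → length xs ≡ ℓ → rotate r xs ≡ rotate (r % ℓ) xs
  rotate-% r xs ℓ refl = begin
    rotate r xs                                 ≡⟨ cong (λ s → rotate s xs) (m≡m%n+[m/n]*n r ℓ) ⟩
    rotate (r % ℓ ℕ.+ (r / ℓ) ℕ.* ℓ) xs         ≡⟨ rotate-+ (r % ℓ) _ xs ⟩
    rotate ((r / ℓ) ℕ.* ℓ) ys                   ≡⟨ subst (λ ℓ′ → rotate ((r / ℓ) ℕ.* ℓ′) ys ≡ ys) (length-rotate (r % ℓ) xs)
                                                     (rotate-*-length (r / ℓ) ys) ⟩
    ys                                          ∎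
    where
      ys = rotate (r % ℓ) xs

  split-at : ∀ d (xs : List A) → d < length xs →
             Σ[ P ∈ List A ] Σ[ q ∈ A ] Σ[ Q ∈ List A ] (xs ≡ P ++ q ∷ Q × length P ≡ d)
  split-at zero    (q ∷ Q)  _           = [] , q , Q , refl , refl
  split-at (suc d) (y ∷ ys) (s≤s d<∣ys∣) with split-at d ys d<∣ys∣
  ... | P , q , Q , refl , refl = y ∷ P , q , Q , refl , refl

  rotate-suc : ∀ d x (xs : List A) → d < length xs →
               Σ[ P ∈ List A ] Σ[ q ∈ A ] Σ[ Q ∈ List A ] (xs ≡ P ++ q ∷ Q × rotate (suc d) (x ∷ xs) ≡ q ∷ Q ++ x ∷ P)
  rotate-suc d x xs d<∣xs∣ with split-at d xs d<∣xs∣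
  ... | P , q , Q , refl , refl = P , q , Q , refl , rotate-++ (x ∷ P) (q ∷ Q)

-- Eulerian circuits

false≢true : false ≢ true
false≢true ()

does-true : ∀ {A : Set} {a? : Dec A} → does a? ≡ true → A
does-true {a? = yes a} _ = a

Unique-map-distinct : ∀ {A B : Set} (f : A → B) a P b Q → Unique (map f (a ∷ P ++ b ∷ Q)) → f a ≢ f b
Unique-map-distinct f a P b Q (fa∉ ∷ _) = All.lookup fa∉ (∈.∈-map⁺ f (∈.∈-insert P))

covered-unique⇒↭ : ∀ {A : Set} (ys xs : List A) → Unique ys → (∀ {y} → y ∈ ys → y ∈ xs) → length xs ≤ length ys → xs ↭ ys
covered-unique⇒↭ []       []       _          _     _   = ↭-refl
covered-unique⇒↭ []       (x ∷ xs) _          _     ()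
covered-unique⇒↭ (y ∷ ys) xs       (y∉ ∷ uys) cover ∣xs∣≤ with ∈.∈-∃++ (cover (here refl))
... | as , bs , refl = ↭-trans (Perm.shift y as bs) (↭-prep y (covered-unique⇒↭ ys (as ++ bs) uys cover′ ∣as++bs∣≤))
  where
    cover′ : ∀ {z} → z ∈ ys → z ∈ as ++ bs
    cover′ {z} z∈ys with ∈.∈-++⁻ as (cover (there z∈ys))
    ... | inj₁ z∈as          = ∈.∈-++⁺ˡ z∈as
    ... | inj₂ (here refl)   = ⊥-elim (All.lookup y∉ z∈ys refl)
    ... | inj₂ (there z∈bs)  = ∈.∈-++⁺ʳ as z∈bs
    ∣as++bs∣≤ : length (as ++ bs) ≤ length ys
    ∣as++bs∣≤ = ℕ.≤-pred (≡.subst (_≤ suc (length ys)) (≡.trans (List.length-++ as) (≡.trans (ℕ.+-suc (length as) (length bs))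
                  (cong suc (sym (List.length-++ as))))) ∣xs∣≤)

module _ (G : Graph) where
  open Graph G

  private
    O = OEdge G

  isWalkᵇ-sound : ∀ x y w → isWalkᵇ G x y w ≡ true → IsWalk G x y w
  isWalkᵇ-sound x y []      x≡y = subst (λ z → IsWalk G x z []) (does-true {a? = x ≟ y} x≡y) nil
  isWalkᵇ-sound x y (a ∷ w) ok with _==V_ G (start G a) x in a-from-x
  ... | true = cons (does-true {a? = start G a ≟ x} a-from-x) (isWalkᵇ-sound (end G a) y w ok)

  isWalkᵇ-complete : ∀ {x y w} → IsWalk G x y w → isWalkᵇ G x y w ≡ true
  isWalkᵇ-complete {x} nil                   = dec-true (x ≟ x) refl
  isWalkᵇ-complete     (cons {a = a} refl p) rewrite dec-true (start G a ≟ start G a) refl = isWalkᵇ-complete p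

  closedWalkᵇ-sound : ∀ w → closedWalkᵇ G w ≡ true → Σ[ u ∈ Fin n ] IsWalk G u u w
  closedWalkᵇ-sound (a ∷ w) closed = start G a , cons refl (isWalkᵇ-sound (end G a) (start G a) w closed)

  circuit-length : ∀ {c} → IsEulerianCircuit G c → length c ≡ m
  circuit-length {c} (_ , c↭E) = ≡.trans (sym (List.length-map (edgeOf G) c))
                                   (≡.trans (Perm.↭-length c↭E) (List.length-tabulate (λ e → e)))

  circuit-unique : ∀ {c} → IsEulerianCircuit G c → Unique (map (edgeOf G) c)
  circuit-unique (_ , c↭E) = PermSetoid.Unique-resp-↭ (≡.setoid (Fin m)) (↭⇒↭ₛ (↭-sym c↭E)) (Unique.allFin⁺ m)

  circuit-odd : ∀ {c} → IsEulerianCircuit G c → ∀ e → odd G e c ≡ true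
  circuit-odd {c} (_ , c↭E) e = begin
    odd G e c                                     ≡⟨ sym (Parity.∑-map c (edgeOf G) (λ k → does (k ≟ e))) ⟩
    ⨁ (map (edgeOf G) c) (λ k → does (k ≟ e))     ≡⟨ Parity.∑-↭ (λ k → does (k ≟ e)) c↭E ⟩
    ⨁ (allFin m) (λ k → does (k ≟ e))             ≡⟨ Parity.∑-allFin {m} _ ⟩
    ⨁ᶠ (λ k → does (k ≟ e))                       ≡⟨ Parity.∑ᶠ-cong (λ k → sym (if-id (does (k ≟ e)))) ⟩
    ⨁ᶠ (λ k → if does (k ≟ e) then true else false) ≡⟨ Parity.∑ᶠ-δ′ e (λ _ → true) ⟩
    true                                          ∎
    where
      if-id : ∀ b → (if b then true else false) ≡ b
      if-id true  = refl
      if-id false = refl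

  eulerianᵇ : List O → Bool
  eulerianᵇ w = closedWalkᵇ G w ∧ andFin G (λ e → odd G e w)

  eulerianᵇ-complete : ∀ {c} → IsEulerianCircuit G c → eulerianᵇ c ≡ true
  eulerianᵇ-complete {a ∷ w} circuit@(cons _ p , _) rewrite isWalkᵇ-complete p = andFin-complete G _ (circuit-odd circuit)

  -- Traversing every edge an odd number of times with only m steps means traversing each edge exactly once.
  eulerianᵇ-sound : ∀ w → length w ≡ m → eulerianᵇ w ≡ true → IsEulerianCircuit G w
  eulerianᵇ-sound (a ∷ w) ∣w∣≡m ok with closedWalkᵇ G (a ∷ w) in closed
  ... | true = cons refl (isWalkᵇ-sound (end G a) (start G a) w closed)
             , covered-unique⇒↭ (allFin m) (map (edgeOf G) (a ∷ w)) (Unique.allFin⁺ m)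
                 (λ {e} _ → odd⇒∈ e (a ∷ w) (andFin-sound G _ ok e))
                 (ℕ.≤-reflexive (≡.trans (List.length-map (edgeOf G) (a ∷ w)) (≡.trans ∣w∣≡m (sym (List.length-tabulate (λ e → e))))))
    where
      odd⇒∈ : ∀ e w → odd G e w ≡ true → e ∈ map (edgeOf G) w
      odd⇒∈ e (b ∷ w) odd-e with does (edgeOf G b ≟ e) in b-is-e
      ... | true  = here (sym (does-true {a? = edgeOf G b ≟ e} b-is-e))
      ... | false = there (odd⇒∈ e w odd-e)

  closedWalk : ∀ {u b bs} → IsWalk G u u (b ∷ bs) → IsClosedWalk G (b ∷ bs)
  closedWalk (cons refl q) = cons refl q

  circuit-rotate₁ : ∀ {c} → IsEulerianCircuit G c → IsEulerianCircuit G (rotate₁ c)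
  circuit-rotate₁ {a ∷ []}     (cons _ p , c↭E) = cons refl p , c↭E
  circuit-rotate₁ {a ∷ b ∷ bs} (cons _ p , c↭E) =
    closedWalk (walk-++ G p (cons refl nil)) ,
    ↭-trans (subst (_↭ map (edgeOf G) (a ∷ b ∷ bs)) (sym (List.map-++ (edgeOf G) (b ∷ bs) [ a ]))
                   (↭-sym (Perm.∷↭∷ʳ (edgeOf G a) (map (edgeOf G) (b ∷ bs))))) c↭E

  circuit-rotate : ∀ r {c} → IsEulerianCircuit G c → IsEulerianCircuit G (rotate r c)
  circuit-rotate zero    circuit = circuit
  circuit-rotate (suc r) circuit = circuit-rotate r (circuit-rotate₁ circuit)

  ∼rot⇒rotate : ∀ {x y} → _∼rot_ G x y → Σ[ r ∈ ℕ ] y ≡ rotate r x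
  ∼rot⇒rotate ε                        = 0 , refl
  ∼rot⇒rotate (fwd (rot1 a as) ◅ rest) with ∼rot⇒rotate rest
  ... | r , y≡ = suc r , y≡
  ∼rot⇒rotate (bwd (rot1 a as) ◅ rest) with ∼rot⇒rotate rest
  ... | r , y≡ = length as ℕ.+ r , ≡.trans y≡ (≡.trans (cong (rotate r) (sym (rotate-length (a ∷ as))))
                                                      (sym (rotate-+ (length as) r (as ∷ʳ a))))

  rotate⇒∼rot : ∀ r x → _∼rot_ G x (rotate r x)
  rotate⇒∼rot zero    x        = ε
  rotate⇒∼rot (suc r) []       = rotate⇒∼rot r []
  rotate⇒∼rot (suc r) (a ∷ as) = fwd (rot1 a as) ◅ rotate⇒∼rot r (as ∷ʳ a)

  ∼rot-sym : ∀ {x y} → _∼rot_ G x y → _∼rot_ G y x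
  ∼rot-sym = EqClosure.symmetric (Rot1 G)

  rotate-suc-head : ∀ {a as} → IsEulerianCircuit G (a ∷ as) → ∀ d → suc d < m →
                    ∀ {b bs} → rotate (suc d) (a ∷ as) ≡ b ∷ bs → edgeOf G a ≢ edgeOf G b
  rotate-suc-head {a} {as} circuit d d<m with rotate-suc d a as (ℕ.≤-pred (≡.subst (suc d <_) (sym (circuit-length circuit)) d<m))
  ... | P , q , Q , refl , rotated = λ b∷bs≡ → Unique-map-distinct (edgeOf G) a P q Q (circuit-unique circuit)
                                                 ∘ (λ a≡b → ≡.trans a≡b (cong (edgeOf G) (List.∷-injectiveˡ (≡.trans (sym b∷bs≡) rotated))))

  rotate-suc-≢ : ∀ {y} → IsEulerianCircuit G y → ∀ d → suc d < m → rotate (suc d) y ≢ y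
  rotate-suc-≢ {[]}     (() , _)
  rotate-suc-≢ {b ∷ bs} circuit d d<m back = rotate-suc-head circuit d d<m back refl

  rotate-no-return : ∀ {c} → IsEulerianCircuit G c → ∀ {r r′} → r < r′ → r′ < m → rotate r c ≢ rotate r′ c
  rotate-no-return {c} circuit {r} r<r′ r′<m same with ℕ.m≤n⇒∃[o]m+o≡n r<r′
  ... | k , refl = rotate-suc-≢ (circuit-rotate r circuit) k (ℕ.≤-<-trans (ℕ.m≤n+m (suc k) r) (≡.subst (_< m) (sym (ℕ.+-suc r k)) r′<m))
                     (sym (≡.trans same (≡.trans (cong (λ s → rotate s c) (sym (ℕ.+-suc r k))) (rotate-+ r (suc k) c))))

  rotate-injective : ∀ {c} → IsEulerianCircuit G c → ∀ {r r′} → r < m → r′ < m → rotate r c ≡ rotate r′ c → r ≡ r′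
  rotate-injective circuit {r} {r′} r<m r′<m same with ℕ.<-cmp r r′
  ... | tri< r<r′ _ _ = ⊥-elim (rotate-no-return circuit r<r′ r′<m same)
  ... | tri≈ _ r≡r′ _ = r≡r′
  ... | tri> _ _ r′<r = ⊥-elim (rotate-no-return circuit r′<r r<m (sym same))

  private
    ∧-true : ∀ {x y} → x ∧ y ≡ true → x ≡ true × y ≡ true
    ∧-true {true} {true} _ = refl , refl

    ∧-intro : ∀ {x y} → x ≡ true → y ≡ true → x ∧ y ≡ true
    ∧-intro refl refl = refl

  ==O⇒same-edge : ∀ a b → _==O_ G a b ≡ true → edgeOf G a ≡ edgeOf G b
  ==O⇒same-edge (k , _) (l , _) a==b = does-true {a? = k ≟ l} (proj₁ (∧-true a==b))

  distinct-edges⇒¬==O-inv : ∀ a b → edgeOf G a ≢ edgeOf G b → _==O_ G a (inv G b) ≡ false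
  distinct-edges⇒¬==O-inv a b a≢b = ¬-not (a≢b ∘ ==O⇒same-edge a (inv G b))

  ¬==O-inv : ∀ a → _==O_ G a (inv G a) ≡ false
  ¬==O-inv (k , true)  = ∧-zeroʳ _
  ¬==O-inv (k , false) = ∧-zeroʳ _

  chainᵇ-walk : ∀ c w → chainᵇ G c w ≡ true → IsWalk G (end G c) (end G (last G c w)) w
  chainᵇ-walk c []      _     = nil
  chainᵇ-walk c (d ∷ w) chain with ∧-true {feeds G c d} chain
  ... | c-feeds-d , chain′ = cons (sym (does-true {a? = end G c ≟ start G d} (proj₂ (∧-true {not (_==O_ G d (inv G c))} c-feeds-d))))
                                  (chainᵇ-walk d w chain′)

  -- A walk without repeated edges never turns back along the edge it just used.
  chainᵇ-complete : ∀ c w {x y} → IsWalk G x y (c ∷ w) → Unique (map (edgeOf G) (c ∷ w)) → chainᵇ G c w ≡ true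
  chainᵇ-complete c []      _                  _                  = refl
  chainᵇ-complete c (d ∷ w) (cons _ (cons s p)) (c∉ ∷ unique) =
    ∧-intro (∧-intro (cong not (distinct-edges⇒¬==O-inv d c (λ d≡c → All.lookup c∉ (here (sym d≡c)) refl)))
                     (dec-true (end G c ≟ start G d) (sym s)))
            (chainᵇ-complete d w (cons s p) unique)

  cycleᵇ-sound : ∀ c w → cycleᵇ G (c ∷ w) ≡ true → IsWalk G (start G c) (start G c) (c ∷ w)
  cycleᵇ-sound c w cycle with ∧-true {feeds G (last G c w) c} cycle
  ... | closes , chain = cons refl (subst (λ z → IsWalk G (end G c) z w)
                                          (does-true {a? = end G (last G c w) ≟ start G c} (proj₂ (∧-true {not (_==O_ G c (inv G (last G c w)))} closes)))
                                          (chainᵇ-walk c w chain))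

  cycleᵇ-complete : ∀ c w → IsEulerianCircuit G (c ∷ w) → cycleᵇ G (c ∷ w) ≡ true
  cycleᵇ-complete c w circuit@(walk@(cons _ p) , _) =
    ∧-intro (∧-intro (cong not (no-return w (circuit-unique circuit))) (dec-true (end G (last G c w) ≟ start G c) (walk-end p)))
            (chainᵇ-complete c w walk (circuit-unique circuit))
    where
      walk-end : ∀ {b w y} → IsWalk G (end G b) y w → end G (last G b w) ≡ y
      walk-end nil        = refl
      walk-end (cons _ q) = walk-end q
      last-∈ : ∀ d w → last G d w ∈ d ∷ w
      last-∈ d []      = here refl
      last-∈ d (e ∷ w) = there (last-∈ e w)
      no-return : ∀ w → Unique (map (edgeOf G) (c ∷ w)) → _==O_ G c (inv G (last G c w)) ≡ false
      no-return []      _           = ¬==O-inv c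
      no-return (d ∷ w) (c∉ ∷ _) = distinct-edges⇒¬==O-inv c (last G d w) (All.lookup c∉ (∈.∈-map⁺ (edgeOf G) (last-∈ d w)))

  ⨁-δ-walk : ∀ (h : Fin n → Bool) {x y q} → IsWalk G x y q → ⨁ q (δ G h ∘ edgeOf G) ≡ h x xor h y
  ⨁-δ-walk h {x} nil                       = sym (xor-same (h x))
  ⨁-δ-walk h {y = y} (cons {a = a} refl p) = ≡.trans (cong₂ _xor_ (sym (δ-oriented G h a)) (⨁-δ-walk h p))
                                                     (telescope (h (start G a)) (h (end G a)) (h y))
    where
      telescope : ∀ a b c → (a xor b) xor (b xor c) ≡ a xor c
      telescope true  true  c     = refl
      telescope true  false c     = refl
      telescope false true  true  = refl
      telescope false true  false = refl
      telescope false false c     = refl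

  cut-even : ∀ {c} → IsEulerianCircuit G c → ∀ h → ⨁ᶠ (δ G h) ≡ false
  cut-even {c@(a ∷ _)} (walk , c↭E) h = begin
    ⨁ᶠ (δ G h)                  ≡⟨ sym (Parity.∑-allFin (δ G h)) ⟩
    ⨁ (allFin m) (δ G h)        ≡⟨ sym (Parity.∑-↭ (δ G h) c↭E) ⟩
    ⨁ (map (edgeOf G) c) (δ G h) ≡⟨ Parity.∑-map c (edgeOf G) (δ G h) ⟩
    ⨁ c (δ G h ∘ edgeOf G)      ≡⟨ ⨁-δ-walk h walk ⟩
    h (start G a) xor h (start G a) ≡⟨ xor-same (h (start G a)) ⟩
    false                       ∎

module _ (G : Graph) (T : Fin (Graph.m G) → Bool) (connected : TConnected G T) (acyclic : TAcyclic G T)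
         (root : Fin (Graph.n G)) {c} (circuit : IsEulerianCircuit G c) where
  open Graph G
  open SpanningTree G T connected acyclic root

  -- If a closed walk traversed a tree edge e₀ an even number of times but every other edge oddly, it
  -- would cross the fundamental cut of e₀ (an even cut) an odd number of times.
  closedWalk-odd : ∀ {u w} → IsWalk G u u w → (∀ e → T e ≡ false → odd G e w ≡ true) → ∀ e → odd G e w ≡ true
  closedWalk-odd {u} {w} walk odd-off-tree e₀ with odd G e₀ w in even | T e₀ in e₀∈T
  ... | true  | _     = refl
  ... | false | false = ≡.trans (sym even) (odd-off-tree e₀ e₀∈T)
  ... | false | true  = ⊥-elim (false≢true (sym (begin
    true                                                ≡⟨ sym (Parity.∑ᶠ-δ e₀ (λ _ → true)) ⟩
    ⨁ᶠ (λ e → if does (e₀ ≟ e) then true else false)    ≡⟨ Parity.∑ᶠ-cong fundamental-cut ⟩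
    ⨁ᶠ (λ e → cut e ∧ not (odd G e w))                  ≡⟨ Parity.∑ᶠ-cong (λ e → ∧-not (cut e) (odd G e w)) ⟩
    ⨁ᶠ (λ e → cut e xor (cut e ∧ odd G e w))            ≡⟨ Parity.∑ᶠ-distrib-∙ {m} cut _ ⟩
    ⨁ᶠ cut xor ⨁ᶠ (λ e → cut e ∧ odd G e w)             ≡⟨ cong₂ _xor_ (cut-even G circuit ψ) crossings ⟩
    false                                               ∎)))
    where
      ψ : Fin n → Bool
      ψ = potential (λ e → does (e₀ ≟ e))
      cut : Fin m → Bool
      cut = δ G ψ
      ∧-not : ∀ x o → x ∧ not o ≡ x xor (x ∧ o)
      ∧-not true  true  = refl
      ∧-not true  false = refl
      ∧-not false o     = refl
      crossings : ⨁ᶠ (λ e → cut e ∧ odd G e w) ≡ false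
      crossings = ≡.trans (sym (⨁≡⨁ᶠ-odd G cut w)) (≡.trans (⨁-δ-walk G ψ walk) (xor-same (ψ u)))
      fundamental-cut : ∀ e → (if does (e₀ ≟ e) then true else false) ≡ cut e ∧ not (odd G e w)
      fundamental-cut e with T e in e∈T
      ... | true  rewrite δ-potential (λ e → does (e₀ ≟ e)) e e∈T with e₀ ≟ e
      ...   | yes refl rewrite even = refl
      ...   | no  _    = refl
      fundamental-cut e | false rewrite odd-off-tree e e∈T | ∧-zeroʳ (cut e) with e₀ ≟ e
      ...   | yes refl = ⊥-elim (false≢true (≡.trans (sym e∈T) e₀∈T))
      ...   | no  _    = refl

-- Counting Eulerian circuits

∑-words-δ : ∀ {I : Set} (idx : List I) (_≟ᴵ_ : DecidableEquality I) →
            (∀ a → ∑ idx (λ b → 𝟙 (does (a ≟ᴵ b))) ≡ 1ℤ) →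
            ∀ l v → length v ≡ l → ∑ (words idx l) (λ w → 𝟙 (does (List.≡-dec _≟ᴵ_ v w))) ≡ 1ℤ
∑-words-δ idx _≟ᴵ_ once zero    []      _     = refl
∑-words-δ idx _≟ᴵ_ once (suc l) (a ∷ v) ∣v∣≡l = begin
  ∑ (words idx (suc l)) (λ w → 𝟙 (does (≟ʷ (a ∷ v) w)))
    ≡⟨ ∑-concatMap idx (λ b → map (b ∷_) (words idx l)) (λ w → 𝟙 (does (≟ʷ (a ∷ v) w))) ⟩
  ∑ idx (λ b → ∑ (map (b ∷_) (words idx l)) (λ w → 𝟙 (does (≟ʷ (a ∷ v) w))))
    ≡⟨ ∑-cong idx (λ b → ≡.trans (∑-map (words idx l) (b ∷_) (λ w → 𝟙 (does (≟ʷ (a ∷ v) w)))) (first-letter b)) ⟩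
  ∑ idx (λ b → 𝟙 (does (a ≟ᴵ b)))
    ≡⟨ once a ⟩
  1ℤ ∎
  where
    ≟ʷ = List.≡-dec _≟ᴵ_
    first-letter : ∀ b → ∑ (words idx l) (λ w → 𝟙 (does (a ≟ᴵ b) ∧ does (≟ʷ v w))) ≡ 𝟙 (does (a ≟ᴵ b))
    first-letter b with does (a ≟ᴵ b)
    ... | true  = ∑-words-δ idx _≟ᴵ_ once l v (ℕ.suc-injective ∣v∣≡l)
    ... | false = ∑-zero (words idx l) (λ _ → refl)

lookup-injective : ∀ {A : Set} {xs : List A} → Unique xs → ∀ i j → lookup xs i ≡ lookup xs j → i ≡ j
lookup-injective {xs = x ∷ xs} _          zero    zero    _ = refl
lookup-injective {xs = x ∷ xs} (x∉ ∷ _)   zero    (suc j) e = ⊥-elim (All.lookup x∉ (∈.∈-lookup j) e)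
lookup-injective {xs = x ∷ xs} (x∉ ∷ _)   (suc i) zero    e = ⊥-elim (All.lookup x∉ (∈.∈-lookup i) (sym e))
lookup-injective {xs = x ∷ xs} (_ ∷ uxs)  (suc i) (suc j) e = cong suc (lookup-injective uxs i j e)

module _ (G : Graph) where
  open Graph G

  private
    O = OEdge G
    E = allOEdges G

  _≟ₒ_ : DecidableEquality O
  (k , b) ≟ₒ (l , c) = map′ (uncurry (cong₂ _,_)) (λ { refl → refl , refl }) ((k ≟ l) ×-dec (b Bool.≟ c))

  _≟ʷ_ : DecidableEquality (List O)
  _≟ʷ_ = List.≡-dec _≟ₒ_

  module _ .{{_ : NonZero m}} (k : ℕ) (ec : IsEC G k) where

    private
      f : Fin k → List O
      f = proj₁ ec
      circuits : ∀ i → IsEulerianCircuit G (f i)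
      circuits = proj₁ (proj₂ ec)
      cover : ∀ c → IsEulerianCircuit G c → ∃[ i ] (_∼rot_ G c (f i))
      cover = proj₁ (proj₂ (proj₂ ec))
      distinct : ∀ i j → _∼rot_ G (f i) (f j) → i ≡ j
      distinct = proj₂ (proj₂ (proj₂ ec))

    hit : Fin k → Fin m → List O → ℤ
    hit i r w = 𝟙 (does (rotate (toℕ r) (f i) ≟ʷ w))

    ∑-hit-circuit : ∀ w → IsEulerianCircuit G w → ∑ (allFin k) (λ i → ∑ (allFin m) (λ r → hit i r w)) ≡ 1ℤ
    ∑-hit-circuit w circuit with cover w circuit
    ... | i₀ , w∼fi₀ with ∼rot⇒rotate G (∼rot-sym G w∼fi₀)
    ... | s , w≡ = begin
      ∑ (allFin k) (λ i → ∑ (allFin m) (λ r → hit i r w))   ≡⟨ ∑-allFin {k} _ ⟩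
      ∑ᶠ (λ i → ∑ (allFin m) (λ r → hit i r w))             ≡⟨ ∑ᶠ-single _ i₀ other-i ⟩
      ∑ (allFin m) (λ r → hit i₀ r w)                       ≡⟨ ∑-allFin {m} _ ⟩
      ∑ᶠ (λ r → hit i₀ r w)                                 ≡⟨ ∑ᶠ-single _ r₀ other-r ⟩
      hit i₀ r₀ w                                           ≡⟨ cong 𝟙 (dec-true (_ ≟ʷ w) (sym w≡rotate-r₀)) ⟩
      1ℤ                                                    ∎
      where
        r₀ : Fin m
        r₀ = fromℕ< (m%n<n s m)
        w≡rotate-r₀ : w ≡ rotate (toℕ r₀) (f i₀)
        w≡rotate-r₀ = ≡.trans w≡ (≡.trans (rotate-% s (f i₀) m (circuit-length G (circuits i₀)))
                                          (cong (λ t → rotate t (f i₀)) (sym (Fin.toℕ-fromℕ< (m%n<n s m)))))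
        other-i : ∀ i → i ≢ i₀ → ∑ (allFin m) (λ r → hit i r w) ≡ 0ℤ
        other-i i i≢i₀ = ∑-zero (allFin m) (λ r → cong 𝟙 (dec-false (_ ≟ʷ w) (λ rot≡w →
          i≢i₀ (distinct i i₀ (rotate⇒∼rot G (toℕ r) (f i) ◅◅ subst (λ z → _∼rot_ G z (f i₀)) (sym rot≡w) w∼fi₀)))))
        other-r : ∀ r → r ≢ r₀ → hit i₀ r w ≡ 0ℤ
        other-r r r≢r₀ = cong 𝟙 (dec-false (_ ≟ʷ w) (λ rot≡w →
          r≢r₀ (Fin.toℕ-injective (rotate-injective G (circuits i₀) (Fin.toℕ<n r) (Fin.toℕ<n r₀) (≡.trans rot≡w w≡rotate-r₀)))))

    ∑-hit≡𝟙-eulerianᵇ : ∀ w → length w ≡ m → ∑ (allFin k) (λ i → ∑ (allFin m) (λ r → hit i r w)) ≡ 𝟙 (eulerianᵇ G w)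
    ∑-hit≡𝟙-eulerianᵇ w ∣w∣≡m with eulerianᵇ G w in eulerian
    ... | true  = ∑-hit-circuit w (eulerianᵇ-sound G w ∣w∣≡m eulerian)
    ... | false = ∑-zero (allFin k) (λ i → ∑-zero (allFin m) (λ r → cong 𝟙 (dec-false (_ ≟ʷ w) (λ rot≡w →
                    false≢true (≡.trans (sym eulerian) (eulerianᵇ-complete G (subst (IsEulerianCircuit G) rot≡w
                                                               (circuit-rotate G (toℕ r) (circuits i)))))))))

    -- Every Eulerian circuit is, for exactly one i and one r < m, the r-th rotation of f i.
    ∑-eulerianᵇ : ∑ (words E m) (λ w → 𝟙 (eulerianᵇ G w)) ≡ + k * + m
    ∑-eulerianᵇ = begin
      ∑ (words E m) (λ w → 𝟙 (eulerianᵇ G w))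
        ≡⟨ ∑-words-cong E m (λ w ∣w∣≡m → sym (∑-hit≡𝟙-eulerianᵇ w ∣w∣≡m)) ⟩
      ∑ (words E m) (λ w → ∑ (allFin k) (λ i → ∑ (allFin m) (λ r → hit i r w)))
        ≡⟨ ∑-comm (words E m) (allFin k) (λ w i → ∑ (allFin m) (λ r → hit i r w)) ⟩
      ∑ (allFin k) (λ i → ∑ (words E m) (λ w → ∑ (allFin m) (λ r → hit i r w)))
        ≡⟨ ∑-cong (allFin k) (λ i → ∑-comm (words E m) (allFin m) (λ w r → hit i r w)) ⟩
      ∑ (allFin k) (λ i → ∑ (allFin m) (λ r → ∑ (words E m) (hit i r)))
        ≡⟨ ∑-cong (allFin k) (λ i → ∑-cong (allFin m) (λ r →
             ∑-words-δ E _≟ₒ_ (λ a → ∑-oriented-δ G a (λ _ → 1ℤ)) m (rotate (toℕ r) (f i))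
               (≡.trans (length-rotate (toℕ r) (f i)) (circuit-length G (circuits i))))) ⟩
      ∑ (allFin k) (λ i → ∑ (allFin m) (λ r → 1ℤ))
        ≡⟨ ∑-cong (allFin k) (λ i → ≡.trans (∑-const (allFin m) 1ℤ) (≡.trans (ℤ.*-identityʳ _) (cong +_ (List.length-tabulate {n = m} id)))) ⟩
      ∑ (allFin k) (λ i → + m)
        ≡⟨ ≡.trans (∑-const (allFin k) (+ m)) (cong (λ z → + z * + m) (List.length-tabulate {n = k} id)) ⟩
      + k * + m ∎

  ∈-allOEdges : ∀ a → a ∈ E
  ∈-allOEdges (k , b) = ∈.∈-concatMap⁺ (λ k → (k , true) ∷ (k , false) ∷ []) (Any.map (λ { refl → both b }) (∈.∈-allFin k))
    where
      both : ∀ b → (k , b) ∈ (k , true) ∷ (k , false) ∷ []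
      both true  = here refl
      both false = there (here refl)

  ∈-words⁺ : ∀ l w → length w ≡ l → w ∈ words E l
  ∈-words⁺ zero    []      _     = here refl
  ∈-words⁺ (suc l) (a ∷ w) ∣w∣≡l =
    ∈.∈-concatMap⁺ (λ b → map (b ∷_) (words E l)) (Any.map (λ { refl → ∈.∈-map⁺ (a ∷_) (∈-words⁺ l w (ℕ.suc-injective ∣w∣≡l)) }) (∈-allOEdges a))

  ∈-words⁻ : ∀ l w → w ∈ words E l → length w ≡ l
  ∈-words⁻ zero    w (here refl) = refl
  ∈-words⁻ (suc l) w w∈ with Any.satisfied (∈.∈-concatMap⁻ (λ b → map (b ∷_) (words E l)) {xs = E} w∈)
  ... | b , w∈b∷ with ∈.∈-map⁻ (b ∷_) w∈b∷
  ... | w′ , w′∈ , refl = cong suc (∈-words⁻ l w′ w′∈)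

  -- The representatives of the rotation classes are the Eulerian circuits starting with a fixed edge e⋆,
  -- which occurs exactly once in every circuit.
  module Representatives .{{_ : NonZero m}} where

    e⋆ : Fin m
    e⋆ = fromℕ< (ℕ.>-nonZero⁻¹ m)

    startsWith-e⋆ : List O → Bool
    startsWith-e⋆ []      = false
    startsWith-e⋆ (a ∷ _) = does (edgeOf G a ≟ e⋆)

    canonical : List O → Bool
    canonical w = eulerianᵇ G w ∧ startsWith-e⋆ w

    reps : List (List O)
    reps = deduplicate _≟ʷ_ (filterᵇ canonical (words E m))

    rep-canonical : ∀ {w} → w ∈ reps → IsEulerianCircuit G w × startsWith-e⋆ w ≡ true
    rep-canonical {w} w∈ with ∈.∈-filter⁻ (Bool.T? ∘ canonical) (∈.∈-deduplicate⁻ _≟ʷ_ _ w∈)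
    ... | w∈words , _ with eulerianᵇ G w in eulerian | startsWith-e⋆ w
    ... | true | true = eulerianᵇ-sound G w (∈-words⁻ m w w∈words) eulerian , refl

    rep-circuit : ∀ i → IsEulerianCircuit G (lookup reps i)
    rep-circuit i = proj₁ (rep-canonical (∈.∈-lookup i))

    reps-cover : ∀ c → IsEulerianCircuit G c → ∃[ i ] (_∼rot_ G c (lookup reps i))
    reps-cover c c-circuit with ∈.∈-map⁻ (edgeOf G) (Perm.∈-resp-↭ (↭-sym (proj₂ c-circuit)) (∈.∈-allFin e⋆))
    ... | a , a∈c , e⋆≡a with ∈.∈-∃++ a∈c
    ... | P , Q , refl = Any.index c′∈ , subst (_∼rot_ G c) (Any.lookup-index c′∈) (rotate⇒∼rot G (length P) c)
      where
        c′ = rotate (length P) c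
        c′-circuit : IsEulerianCircuit G c′
        c′-circuit = circuit-rotate G (length P) c-circuit
        c′-canonical : canonical c′ ≡ true
        c′-canonical rewrite eulerianᵇ-complete G c′-circuit | rotate-++ P (a ∷ Q) | sym e⋆≡a = dec-true (e⋆ ≟ e⋆) refl
        c′∈ : c′ ∈ reps
        c′∈ = ∈.∈-deduplicate⁺ _≟ʷ_ (∈.∈-filter⁺ (Bool.T? ∘ canonical) (∈-words⁺ m c′ (circuit-length G c′-circuit))
                                                (Equivalence.from T-≡ c′-canonical))

    no-rotation-between-reps : ∀ x y → IsEulerianCircuit G x × startsWith-e⋆ x ≡ true → startsWith-e⋆ y ≡ true →
                               ∀ d → suc d < m → rotate (suc d) x ≢ y
    no-rotation-between-reps (a ∷ as) (b ∷ bs) (x-circuit , a-e⋆) b-e⋆ d d<m rotated =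
      rotate-suc-head G x-circuit d d<m rotated
        (≡.trans (does-true {a? = edgeOf G a ≟ e⋆} a-e⋆) (sym (does-true {a? = edgeOf G b ≟ e⋆} b-e⋆)))

    reps-distinct : ∀ i j → _∼rot_ G (lookup reps i) (lookup reps j) → i ≡ j
    reps-distinct i j fi∼fj with ∼rot⇒rotate G fi∼fj
    ... | r , fj≡ = lookup-injective (Unique.deduplicate-! _≟ʷ_ (filterᵇ canonical (words E m))) i j
                      (sym (no-shift (r % m) (m%n<n r m) (≡.trans fj≡ (rotate-% r fi m (circuit-length G (rep-circuit i))))))
      where
        fi = lookup reps i
        fj = lookup reps j
        no-shift : ∀ s → s < m → fj ≡ rotate s fi → fj ≡ fi
        no-shift zero    _   fj≡fi = fj≡fi
        no-shift (suc d) d<m fj≡   = ⊥-elim (no-rotation-between-reps fi fj (rep-canonical (∈.∈-lookup i))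
                                               (proj₂ (rep-canonical (∈.∈-lookup j))) d d<m (sym fj≡))

  ∃-IsEC : .{{_ : NonZero m}} → ∃[ k ] IsEC G k
  ∃-IsEC = length reps , lookup reps , rep-circuit , reps-cover , reps-distinct
    where open Representatives

-- The trace formulas

private
  true⇔true⇒≡ : ∀ {x y} → (x ≡ true → y ≡ true) → (y ≡ true → x ≡ true) → x ≡ y
  true⇔true⇒≡ {true}  x⇒y _   = sym (x⇒y refl)
  true⇔true⇒≡ {false} {false} _ _ = refl
  true⇔true⇒≡ {false} {true}  _ y⇒x = y⇒x refl

module _ (G : Graph) (T : Fin (Graph.m G) → Bool) (connected : TConnected G T) (acyclic : TAcyclic G T)
         (root : Fin (Graph.n G)) {c} (circuit : IsEulerianCircuit G c) .{{_ : NonZero (Graph.m G)}} where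
  open Graph G

  private
    O = OEdge G
    E = allOEdges G

  tree-or-odd : ∀ {u w} → IsWalk G u u w → andFin G (λ e → T e ∨ odd G e w) ≡ andFin G (λ e → odd G e w)
  tree-or-odd walk = true⇔true⇒≡
    (λ off-tree → andFin-complete G _ (closedWalk-odd G T connected acyclic root circuit walk
      (λ e e∉T → ≡.subst (λ t → t ∨ _ ≡ true) e∉T (andFin-sound G _ off-tree e))))
    (λ all-odd → andFin-complete G _ (λ e → ≡.trans (cong (T e ∨_) (andFin-sound G _ all-odd e)) (∨-zeroʳ (T e))))

  -- tr γ is the trace of the m-th power of W₁,γ or A_γ, and P the matching test on words.
  twisted-trace-sum : (tr : (Fin m → Bool) → ℤ) (P : List O → Bool) →
    (∀ γ → tr γ ≡ ∑ (words E m) (λ w → if P w then ∏ w (χ G γ) else 0ℤ)) →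
    (∀ w → P w ≡ true → Σ[ u ∈ Fin n ] IsWalk G u u w) →
    (∀ w → length w ≡ m → P w ∧ andFin G (λ e → odd G e w) ≡ eulerianᵇ G w) →
    ∀ k → IsEC G k → + m * ((+ 2) ^ genus G) * + k ≡ sumList G (map (λ γ → (- 1ℤ) ^ σ G γ * tr γ) (M2 G T))
  twisted-trace-sum tr P tr≡ P-closed P-eulerian k ec = sym (begin
    sumList G (map (λ γ → (- 1ℤ) ^ σ G γ * tr γ) (M2 G T))
      ≡⟨ sumList≡∑ G (M2 G T) _ ⟩
    ∑ (M2 G T) (λ γ → (- 1ℤ) ^ σ G γ * tr γ)
      ≡⟨ ∑-cong (M2 G T) (λ γ → ≡.trans (cong (sign γ *_) (tr≡ γ)) (*-distribˡ-∑ (sign γ) (words E m) _)) ⟩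
    ∑ (M2 G T) (λ γ → ∑ (words E m) (λ w → sign γ * term γ w))
      ≡⟨ ∑-comm (M2 G T) (words E m) (λ γ w → sign γ * term γ w) ⟩
    ∑ (words E m) (λ w → ∑ (M2 G T) (λ γ → sign γ * term γ w))
      ≡⟨ ∑-words-cong E m per-word ⟩
    ∑ (words E m) (λ w → cotreeWeight G T * 𝟙 (eulerianᵇ G w))
      ≡⟨ sym (*-distribˡ-∑ (cotreeWeight G T) (words E m) _) ⟩
    cotreeWeight G T * ∑ (words E m) (λ w → 𝟙 (eulerianᵇ G w))
      ≡⟨ cong₂ _*_ (SpanningTree.cotreeWeight≡2^genus G T connected acyclic root) (∑-eulerianᵇ G k ec) ⟩
    (+ 2) ^ genus G * (+ k * + m)
      ≡⟨ cong ((+ 2) ^ genus G *_) (ℤ.*-comm (+ k) (+ m)) ⟩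
    (+ 2) ^ genus G * (+ m * + k)
      ≡⟨ sym (ℤ.*-assoc ((+ 2) ^ genus G) (+ m) (+ k)) ⟩
    (+ 2) ^ genus G * + m * + k
      ≡⟨ cong (_* + k) (ℤ.*-comm ((+ 2) ^ genus G) (+ m)) ⟩
    + m * ((+ 2) ^ genus G) * + k ∎)
    where
      sign : (Fin m → Bool) → ℤ
      sign γ = (- 1ℤ) ^ σ G γ
      term : (Fin m → Bool) → List O → ℤ
      term γ w = if P w then ∏ w (χ G γ) else 0ℤ
      per-word : ∀ w → length w ≡ m → ∑ (M2 G T) (λ γ → sign γ * term γ w) ≡ cotreeWeight G T * 𝟙 (eulerianᵇ G w)
      per-word w ∣w∣≡m with P w in Pw | P-eulerian w ∣w∣≡m
      ... | false | false≡eulerian = begin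
        ∑ (M2 G T) (λ γ → sign γ * 0ℤ)         ≡⟨ ∑-zero (M2 G T) (λ γ → ℤ.*-zeroʳ (sign γ)) ⟩
        0ℤ                                     ≡⟨ sym (ℤ.*-zeroʳ (cotreeWeight G T)) ⟩
        cotreeWeight G T * 𝟙 false             ≡⟨ cong (λ b → cotreeWeight G T * 𝟙 b) false≡eulerian ⟩
        cotreeWeight G T * 𝟙 (eulerianᵇ G w)   ∎
      ... | true | odd≡eulerian with P-closed w Pw
      ... | u , walk = begin
        ∑ (M2 G T) (λ γ → sign γ * ∏ w (χ G γ))                     ≡⟨ ∑-M₂-sign G T w ⟩
        cotreeWeight G T * 𝟙 (andFin G (λ e → T e ∨ odd G e w))     ≡⟨ cong (λ b → cotreeWeight G T * 𝟙 b) (tree-or-odd walk) ⟩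
        cotreeWeight G T * 𝟙 (andFin G (λ e → odd G e w))           ≡⟨ cong (λ b → cotreeWeight G T * 𝟙 b) odd≡eulerian ⟩
        cotreeWeight G T * 𝟙 (eulerianᵇ G w)                        ∎

module _ (G : Graph) where
  open Graph G

  cycleᵇ-closed : ∀ w → cycleᵇ G w ≡ true → Σ[ u ∈ Fin n ] IsWalk G u u w
  cycleᵇ-closed (c ∷ w) cycle = start G c , cycleᵇ-sound G c w cycle

  cycleᵇ-eulerian : ∀ w → length w ≡ m → cycleᵇ G w ∧ andFin G (λ e → odd G e w) ≡ eulerianᵇ G w
  cycleᵇ-eulerian []      _     = refl
  cycleᵇ-eulerian (c ∷ w) ∣w∣≡m with cycleᵇ G (c ∷ w) in cycle
  ... | false = sym (¬-not (λ eulerian →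
                  false≢true (≡.trans (sym cycle) (cycleᵇ-complete G c w (eulerianᵇ-sound G (c ∷ w) ∣w∣≡m eulerian)))))
  ... | true  with cycleᵇ-sound G c w cycle
  ...   | cons _ walk rewrite isWalkᵇ-complete G walk = refl

theorem1p1 : (G : Graph) → Connected G → Eulerian G →
    (T : Fin (Graph.m G) → Bool) → IsSpanningTree G T →
    (∃[ k ] IsEC G k)
    × (∀ k → IsEC G k →
    ((+ Graph.m G) * ((+ 2) ^ genus G) * (+ k) ≡ sumW G T)
    × ((+ Graph.m G) * ((+ 2) ^ genus G) * (+ k) ≡ sumA G T))
theorem1p1 G _ (c₀ ∷ cs , circuit) T (connected , acyclic) =
  ∃-IsEC G , λ k ec →
    twisted-trace-sum G T connected acyclic root circuit _ (cycleᵇ G)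
      (λ γ → trace-pow-W1γ G γ m) (cycleᵇ-closed G) (cycleᵇ-eulerian G) k ec ,
    twisted-trace-sum G T connected acyclic root circuit _ (closedWalkᵇ G)
      (λ γ → trace-pow-Aγ G γ m) (closedWalkᵇ-sound G) (λ _ _ → refl) k ec
  where
    open Graph G using (m)
    root : Fin (Graph.n G)
    root = start G c₀
    instance
      m≢0 : NonZero m
      m≢0 = ≡.subst NonZero (circuit-length G circuit) _
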